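{- Every claw-free cubic graph $G$ admits a $(1,1,1,3)$-packing edge-coloring; that is, $E(G)$ can be partitioned into sets $E_1, E_2, E_3, E_4$ such that each of $E_1, E_2, E_3$ is a matching (any two distinct edges in the same set are at edge-distance at least $2$), and any two distinct edges of $E_4$ are at edge-distance at least $4$.
   Context: Graphs are finite and simple. A graph is claw-free if it contains no induced subgraph isomorphic to $K_{1,3}$; it is cubic if every vertex has degree $3$. The edge-distance between two edges of $G$ is their distance as vertices in the line graph of $G$. For a non-decreasing sequence of positive integers $S=(s_1,\dots,s_k)$, an $S$-packing edge-coloring of $G$ is a partition of $E(G)$ into sets $E_1,\dots,E_k$ such that for each $i$, any two distinct edges of $E_i$ have edge-distance at least $s_i+1$. -}

module Defs where

open import Data.Nat using (ℕ; suc)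
open import Data.Fin using (Fin)
open import Data.Vec using (Vec; lookup; _∷_; [])
open import Data.Product using (Σ; Σ-syntax; _×_; _,_)
open import Data.Sum using (_⊎_)
open import Relation.Nullary using (¬_; Dec)
open import Relation.Binary.PropositionalEquality using (_≡_; _≢_)

record Graph (n : ℕ) : Set₁ where
  field
    Adj    : Fin n → Fin n → Set
    sym    : ∀ {u v} → Adj u v → Adj v u
    irrefl : ∀ {u} → ¬ Adj u u
    dec    : ∀ u v → Dec (Adj u v)
open Graph public

module _ {n : ℕ} (G : Graph n) where

  Cubic : Set
  Cubic = ∀ v → Σ[ a ∈ Fin n ] Σ[ b ∈ Fin n ] Σ[ c ∈ Fin n ]
            (Adj G v a × Adj G v b × Adj G v c ×
             a ≢ b × a ≢ c × b ≢ c ×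
             (∀ w → Adj G v w → (w ≡ a ⊎ w ≡ b ⊎ w ≡ c)))

  ClawFree : Set
  ClawFree = ∀ v a b c → ¬ (Adj G v a × Adj G v b × Adj G v c ×
                            a ≢ b × a ≢ c × b ≢ c ×
                            ¬ Adj G a b × ¬ Adj G a c × ¬ Adj G b c)

  -- an (oriented representative of an) edge
  Edge : Set
  Edge = Σ[ u ∈ Fin n ] Σ[ v ∈ Fin n ] Adj G u v

  SameEdge : Edge → Edge → Set
  SameEdge (u , v , _) (u' , v' , _) = (u ≡ u' × v ≡ v') ⊎ (u ≡ v' × v ≡ u')

  LAdj : Edge → Edge → Set
  LAdj e@(u , v , _) f@(u' , v' , _) =
    ¬ SameEdge e f × (u ≡ u' ⊎ u ≡ v' ⊎ v ≡ u' ⊎ v ≡ v')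

  -- Within e f k : edge-distance (distance in L(G)) between e and f is ≤ k
  data Within : Edge → Edge → ℕ → Set where
    here : ∀ {e f k} → SameEdge e f → Within e f k
    step : ∀ {e g f k} → LAdj e g → Within g f k → Within e f (suc k)

  -- S-packing edge-colouring with S = (s_1,…,s_k): a map assigning each
  -- edge a class, such that two distinct edges in class i have
  -- edge-distance ≥ s_i + 1, i.e. not ≤ s_i.
  PackingEdgeColoring : ∀ {k} → Vec ℕ k → Set
  PackingEdgeColoring {k} s =
    Σ[ col ∈ (Edge → Fin k) ]
      ((∀ e f → SameEdge e f → col e ≡ col f) ×
       (∀ e f → ¬ SameEdge e f → col e ≡ col f →
          ¬ Within e f (lookup s (col e))))

{-# OPTIONS --safe #-}
module Submission where

-- Every vertex of a claw-free cubic graph lies in a triangle and has at most one neighbour, its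
-- mate, sharing no triangle with it. Vertices without a mate lie in K4 components or are the
-- middle vertices of diamonds (K4 minus an edge). Contracting the triangles whose three vertices
-- have mates gives a multigraph of maximum degree 3 whose edges are mate pairs. A locally maximal
-- cut of it leaves at most one uncut edge at each node; uncut edges and the middle edges of
-- diamonds form the sparse class ε, while the cut edges form a bipartite multigraph of maximum
-- degree 3, which König's alternating-path argument colours with the three matching colours.
-- The other edges of triangles and diamonds are then coloured by a local rule, and each K4 by its
-- perfect matchings. As each node meets at most one ε-edge and no side of a diamond is an ε-edge,
-- the ends of two distinct ε-edges are at distance at least 3.

open import Defs using (Graph; ClawFree; Cubic; Edge; SameEdge; LAdj; Within; here; step; PackingEdgeColoring)
open import Data.Nat using (ℕ; zero; suc; _+_; _∸_; _≤_; _<_; z≤n; s≤s; s≤s⁻¹; _≤?_)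
open import Data.Nat.Properties
  using (≤-refl; ≤-reflexive; ≤-trans; <⇒≤; ≰⇒>; +-mono-≤; +-monoʳ-<; +-cancelʳ-<; +-identityʳ;
         m≤m+n; m≤n+m; m∸n+n≡m; +-0-commutativeMonoid; module ≤-Reasoning)
open import Algebra.Properties.CommutativeMonoid.Sum +-0-commutativeMonoid using (sum; ∑-distrib-+; sum-replicate-zero)
open import Data.Vec using (Vec; _∷_; []; lookup)
open import Data.Fin using (Fin; zero; suc; toℕ; fromℕ<)
  renaming (_≟_ to _≟F_; _≤_ to _≤F_; _≤?_ to _≤?F_; _<?_ to _<?F_)
open import Data.Fin.Patterns using (0F; 1F; 2F; 3F)
open import Data.Fin.Properties using (pigeonhole; toℕ-fromℕ<; toℕ<n; any?; all?)
import Data.Fin.Properties as Finₚ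
open import Data.Bool using (Bool; true; false; not; _xor_; if_then_else_) renaming (_≟_ to _≟B_)
open import Data.Bool.Properties using (not-¬; ¬-not; not-involutive; not-distribˡ-xor; not-distribʳ-xor)
open import Data.Maybe using (Maybe; just; nothing; fromMaybe; _>>=_) renaming (map to mapMaybe)
open import Data.Maybe.Properties using (just-injective) renaming (≡-dec to ≡-dec-Maybe)
open import Data.Product using (Σ; _×_; _,_; proj₁; proj₂)
open import Data.Sum using (_⊎_; inj₁; inj₂; [_,_]′) renaming (map₁ to ⊎-map₁; swap to ⊎-swap)
open import Data.Empty using (⊥; ⊥-elim)
open import Data.List using (List; []; _∷_; allFin; length)
open import Data.List.Membership.Propositional using (_∈_)
open import Data.List.Membership.Propositional.Properties using (∈-allFin)
open import Data.List.Relation.Unary.Any using (here; there)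
open import Function using (_∘_; case_of_)
open import Relation.Nullary using (¬_; Dec; yes; no; does)
open import Relation.Nullary.Decidable
  using (_×-dec_; _⊎-dec_; _→-dec_; ¬?; from-yes; toSum; dec-true; dec-false; decidable-stable)
open import Relation.Binary using (tri<; tri≈; tri>)
open import Relation.Binary.PropositionalEquality
  using (_≡_; _≢_; refl; sym; trans; cong; cong₂; subst; subst₂; ≢-sym; module ≡-Reasoning)

-- ε = 3F is the sparse colour (index 3 of the sequence (1,1,1,3)) and the identity of the
-- Klein four-group _⊕_; 0F, 1F, 2F are the three matching colours.
Colour : Set
Colour = Fin 4

pattern ε = 3F

infixl 6 _⊕_
_⊕_ : Colour → Colour → Colour
ε  ⊕ b  = b
a  ⊕ ε  = a
0F ⊕ 0F = ε
0F ⊕ 1F = 2F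
0F ⊕ 2F = 1F
1F ⊕ 0F = 2F
1F ⊕ 1F = ε
1F ⊕ 2F = 0F
2F ⊕ 0F = 1F
2F ⊕ 1F = 0F
2F ⊕ 2F = ε

next : Colour → Colour
next 0F = 1F
next 1F = 2F
next _  = 0F

-- The colour of the edge xy of a triangle xyw whose third edges at x, y, w have the colours a, b, c.
triangleColour : Colour → Colour → Colour → Colour
triangleColour a b ε = a ⊕ b
triangleColour a b c = c

-- A diamond with middle edge ab (coloured ε) and outer vertices c, d whose third edges carry the
-- colours k, k′: the sides ca, cb, da, db get diamondColour k k′ σ, diamondColour k k′ (not σ),
-- diamondColour k′ k (not σ), diamondColour k′ k σ.
diamondColour : Colour → Colour → Bool → Colour
diamondColour k k′ σ with k ≟F k′ | σ
... | yes _ | true  = next k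
... | yes _ | false = next (next k)
... | no _  | true  = k ⊕ k′
... | no _  | false = k′

all-Bool? : {P : Bool → Set} → (∀ b → Dec (P b)) → Dec (∀ b → P b)
all-Bool? P? with P? true | P? false
... | yes t | yes f = yes λ { true → t ; false → f }
... | no ¬t | _     = no λ h → ¬t (h true)
... | _     | no ¬f = no λ h → ¬f (h false)

⊕-comm : ∀ a b → a ⊕ b ≡ b ⊕ a
⊕-comm = from-yes (all? λ a → all? λ b → a ⊕ b ≟F b ⊕ a)

⊕-cancelˡ : ∀ a b c → a ⊕ b ≡ a ⊕ c → b ≡ c
⊕-cancelˡ = from-yes (all? λ a → all? λ b → all? λ c → (a ⊕ b ≟F a ⊕ c) →-dec (b ≟F c))

⊕-≢ε : ∀ a b → a ≢ b → a ⊕ b ≢ ε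
⊕-≢ε = from-yes (all? λ a → all? λ b → ¬? (a ≟F b) →-dec ¬? (a ⊕ b ≟F ε))

triangleColour-comm : ∀ a b z → triangleColour a b z ≡ triangleColour b a z
triangleColour-comm = from-yes (all? λ a → all? λ b → all? λ z →
  triangleColour a b z ≟F triangleColour b a z)

triangleColour-≢ε : ∀ a b z → a ≢ b → triangleColour a b z ≢ ε
triangleColour-≢ε = from-yes (all? λ a → all? λ b → all? λ z →
  ¬? (a ≟F b) →-dec ¬? (triangleColour a b z ≟F ε))

Distinct₃ : Colour → Colour → Colour → Set
Distinct₃ a b c = a ≢ b × a ≢ c × b ≢ c

Distinct₃? : ∀ a b c → Dec (Distinct₃ a b c)
Distinct₃? a b c = ¬? (a ≟F b) ×-dec ¬? (a ≟F c) ×-dec ¬? (b ≟F c)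

Distinct₃-subst : ∀ {a b c a′ b′ c′} → a ≡ a′ → b ≡ b′ → c ≡ c′ →
                  Distinct₃ a′ b′ c′ → Distinct₃ a b c
Distinct₃-subst refl refl refl d = d

triangleColour-proper : ∀ a b z → Distinct₃ a b z →
                        Distinct₃ a (triangleColour a b z) (triangleColour a z b)
triangleColour-proper = from-yes (all? λ a → all? λ b → all? λ z →
  Distinct₃? a b z →-dec Distinct₃? a (triangleColour a b z) (triangleColour a z b))

diamondColour-proper-outer : ∀ k k′ σ → k ≢ ε → k′ ≢ ε →
  Distinct₃ k (diamondColour k k′ σ) (diamondColour k k′ (not σ))
diamondColour-proper-outer = from-yes (all? λ k → all? λ k′ → all-Bool? λ σ →
  ¬? (k ≟F ε) →-dec ¬? (k′ ≟F ε) →-dec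
  Distinct₃? k (diamondColour k k′ σ) (diamondColour k k′ (not σ)))

diamondColour-proper-middle : ∀ k k′ σ → k ≢ ε → k′ ≢ ε →
  Distinct₃ ε (diamondColour k k′ σ) (diamondColour k′ k (not σ))
diamondColour-proper-middle = from-yes (all? λ k → all? λ k′ → all-Bool? λ σ →
  ¬? (k ≟F ε) →-dec ¬? (k′ ≟F ε) →-dec
  Distinct₃? ε (diamondColour k k′ σ) (diamondColour k′ k (not σ)))

freeColour : ∀ a b → Σ Colour λ α → α ≢ ε × a ≢ α × b ≢ α
freeColour = from-yes (all? λ a → all? λ b → any? λ (α : Colour) →
  ¬? (α ≟F ε) ×-dec ¬? (a ≟F α) ×-dec ¬? (b ≟F α))

𝟙 : {A : Set} → Dec A → ℕ
𝟙 d = if does d then 1 else 0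

𝟙-yes : {A : Set} (d : Dec A) → A → 𝟙 d ≡ 1
𝟙-yes d a rewrite dec-true d a = refl

𝟙-no : {A : Set} (d : Dec A) → ¬ A → 𝟙 d ≡ 0
𝟙-no d ¬a rewrite dec-false d ¬a = refl

𝟙≤1 : {A : Set} (d : Dec A) → 𝟙 d ≤ 1
𝟙≤1 (yes _) = ≤-refl
𝟙≤1 (no _)  = z≤n

𝟙-mono : {A B : Set} (d : Dec A) (e : Dec B) → (A → B) → 𝟙 d ≤ 𝟙 e
𝟙-mono (yes a) e f = ≤-reflexive (sym (𝟙-yes e (f a)))
𝟙-mono (no _)  e f = z≤n

sum-mono-≤ : ∀ {k} {f g : Fin k → ℕ} → (∀ i → f i ≤ g i) → sum f ≤ sum g
sum-mono-≤ {zero}  f≤g = z≤n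
sum-mono-≤ {suc k} {f} {g} f≤g =
  +-mono-≤ (f≤g zero) (sum-mono-≤ {f = λ i → f (suc i)} {g = λ i → g (suc i)} (λ i → f≤g (suc i)))

sum-𝟙-≡ : ∀ {k} (a : Fin k) → sum (λ i → 𝟙 (i ≟F a)) ≡ 1
sum-𝟙-≡ {suc k} zero    = cong suc (sum-replicate-zero k)
sum-𝟙-≡ {suc k} (suc a) = sum-𝟙-≡ a

sum-<-exchange : ∀ {k} (f g L R : Fin k → ℕ) → (∀ i → f i + L i ≤ g i + R i) →
                 sum R < sum L → sum f < sum g
sum-<-exchange f g L R pointwise R<L = +-cancelʳ-< (sum L) (sum f) (sum g) (begin-strict
  sum f + sum L          ≡⟨ ∑-distrib-+ f L ⟨
  sum (λ i → f i + L i)  ≤⟨ sum-mono-≤ pointwise ⟩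
  sum (λ i → g i + R i)  ≡⟨ ∑-distrib-+ g R ⟩
  sum g + sum R          <⟨ +-monoʳ-< (sum g) R<L ⟩
  sum g + sum L          ∎)
  where open ≤-Reasoning

hits : ∀ {k} → List (Fin k) → Fin k → ℕ
hits []       i = 0
hits (a ∷ as) i = 𝟙 (i ≟F a) + hits as i

sum-hits : ∀ {k} (as : List (Fin k)) → sum (hits as) ≡ length as
sum-hits {k} []       = sum-replicate-zero k
sum-hits     (a ∷ as) = begin
  sum (hits (a ∷ as))                          ≡⟨ ∑-distrib-+ (λ i → 𝟙 (i ≟F a)) (hits as) ⟩
  sum (λ i → 𝟙 (i ≟F a)) + sum (hits as)       ≡⟨ cong₂ _+_ (sum-𝟙-≡ a) (sum-hits as) ⟩
  suc (length as)                              ∎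
  where open ≡-Reasoning

_⊓F_ : ∀ {k} → Fin k → Fin k → Fin k
a ⊓F b with a ≤?F b
... | yes _ = a
... | no _  = b

⊓F-sel : ∀ {k} (a b : Fin k) → a ⊓F b ≡ a ⊎ a ⊓F b ≡ b
⊓F-sel a b with a ≤?F b
... | yes _ = inj₁ refl
... | no _  = inj₂ refl

⊓F-≤ˡ : ∀ {k} (a b : Fin k) → a ⊓F b ≤F a
⊓F-≤ˡ a b with a ≤?F b
... | yes _  = Finₚ.≤-refl
... | no a≰b = <⇒≤ (≰⇒> a≰b)

⊓F-≤ʳ : ∀ {k} (a b : Fin k) → a ⊓F b ≤F b
⊓F-≤ʳ a b with a ≤?F b
... | yes a≤b = a≤b
... | no _    = Finₚ.≤-refl

_<ᵇ_ : ∀ {k} → Fin k → Fin k → Bool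
a <ᵇ b = does (a <?F b)

<ᵇ-flip : ∀ {k} {a b : Fin k} → a ≢ b → b <ᵇ a ≡ not (a <ᵇ b)
<ᵇ-flip {a = a} {b} a≢b with Finₚ.<-cmp a b
... | tri< a<b _ b≮a = trans (dec-false (b <?F a) b≮a) (cong not (sym (dec-true (a <?F b) a<b)))
... | tri≈ _ a≡b _   = ⊥-elim (a≢b a≡b)
... | tri> a≮b _ b<a = trans (dec-true (b <?F a) b<a) (cong not (sym (dec-false (a <?F b) a≮b)))

module Orbit {n : ℕ} (f : Fin n → Maybe (Fin n)) (a : Fin n) where

  orbit : ℕ → Maybe (Fin n)
  orbit zero    = just a
  orbit (suc i) = orbit i >>= f

  orbit-shift : ∀ {i j} d → orbit i ≡ orbit j → orbit (d + i) ≡ orbit (d + j)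
  orbit-shift zero    e = e
  orbit-shift (suc d) e = cong (_>>= f) (orbit-shift d e)

  orbit-stops : ∀ {i} d → orbit i ≡ nothing → orbit (d + i) ≡ nothing
  orbit-stops zero    e = e
  orbit-stops (suc d) e = cong (_>>= f) (orbit-stops d e)

  orbit-defined : ∀ {i j y} → orbit i ≡ just y → j ≤ i → Σ (Fin n) λ z → orbit j ≡ just z
  orbit-defined {i} {j} e j≤i with orbit j in eq
  ... | just z  = z , refl
  ... | nothing with () ← trans (sym e) (trans (cong orbit (sym (m∸n+n≡m j≤i))) (orbit-stops (i ∸ j) eq))

  -- Pigeonhole: among the first n + 1 points of a longer orbit two coincide.
  orbit-shortcut : ∀ {i y} → n < i → orbit i ≡ just y → Σ ℕ λ i′ → i′ < i × orbit i′ ≡ just y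
  orbit-shortcut {i} {y} n<i e = shortcut (pigeonhole ≤-refl point)
    where
      prefix≤i : (j : Fin (suc n)) → toℕ j ≤ i
      prefix≤i j = ≤-trans (s≤s⁻¹ (toℕ<n j)) (<⇒≤ n<i)
      point : Fin (suc n) → Fin n
      point j = proj₁ (orbit-defined e (prefix≤i j))
      point-spec : ∀ j → orbit (toℕ j) ≡ just (point j)
      point-spec j = proj₂ (orbit-defined e (prefix≤i j))
      shortcut : (Σ (Fin (suc n)) λ j₁ → Σ (Fin (suc n)) λ j₂ → toℕ j₁ < toℕ j₂ × point j₁ ≡ point j₂) →
                 Σ ℕ λ i′ → i′ < i × orbit i′ ≡ just y
      shortcut (j₁ , j₂ , j₁<j₂ , same) = d + toℕ j₁ , shorter , (begin
          orbit (d + toℕ j₁)  ≡⟨ orbit-shift d (trans (point-spec j₁) (trans (cong just same) (sym (point-spec j₂)))) ⟩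
          orbit (d + toℕ j₂)  ≡⟨ cong orbit (m∸n+n≡m (prefix≤i j₂)) ⟩
          orbit i             ≡⟨ e ⟩
          just y              ∎)
        where
          open ≡-Reasoning
          d : ℕ
          d = i ∸ toℕ j₂
          shorter : d + toℕ j₁ < i
          shorter = ≤-trans (+-monoʳ-< d j₁<j₂) (≤-reflexive (m∸n+n≡m (prefix≤i j₂)))

  orbit-bounded : ∀ {i y} → orbit i ≡ just y → Σ (Fin (suc n)) λ j → orbit (toℕ j) ≡ just y
  orbit-bounded {i} = go (suc i) i ≤-refl
    where
      go : ∀ k i {y} → i < k → orbit i ≡ just y → Σ (Fin (suc n)) λ j → orbit (toℕ j) ≡ just y
      go (suc k) i (s≤s i≤k) e with i ≤? n
      ... | yes i≤n = fromℕ< (s≤s i≤n) , trans (cong orbit (toℕ-fromℕ< (s≤s i≤n))) e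
      ... | no i≰n with orbit-shortcut (≰⇒> i≰n) e
      ...   | i′ , i′<i , e′ = go k i′ (≤-trans i′<i i≤k) e′

-- The multigraph obtained by contracting triangles: its edges are the pairs {x , mate x} of
-- matched vertices, its nodes the triples {x , sibling₁ x , sibling₂ x} of inner vertices.
-- A matched vertex that is not inner is a loose end of its edge.
record Skeleton (n : ℕ) : Set₁ where
  field
    Matched            : Fin n → Set
    Matched?           : ∀ x → Dec (Matched x)
    Inner              : Fin n → Set
    Inner?             : ∀ x → Dec (Inner x)
    Inner⇒Matched      : ∀ {x} → Inner x → Matched x
    mate               : Fin n → Fin n
    mate-Matched       : ∀ {x} → Matched x → Matched (mate x)
    mate-involutive    : ∀ {x} → Matched x → mate (mate x) ≡ x
    mate-≢             : ∀ {x} → Matched x → mate x ≢ x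
    sibling₁ sibling₂  : Fin n → Fin n

  Sibling : Fin n → Fin n → Set
  Sibling x y = Inner x × (y ≡ sibling₁ x ⊎ y ≡ sibling₂ x)

  field
    Sibling-sym        : ∀ {x y} → Sibling x y → Sibling y x
    Sibling-trans      : ∀ {x y z} → Sibling x y → Sibling x z → y ≢ z → Sibling y z
    Sibling-irrefl     : ∀ {x y} → Sibling x y → x ≢ y
    mate-not-Sibling   : ∀ {x} → Matched x → ¬ Sibling x (mate x)

record SkeletonColouring {n : ℕ} (H : Skeleton n) : Set where
  open Skeleton H
  field
    κ            : Fin n → Colour
    κ-mate       : ∀ {x} → Matched x → κ (mate x) ≡ κ x
    κ-Sibling    : ∀ {x y} → Sibling x y → κ x ≢ κ y
    κ-ε⇒Inner    : ∀ {x} → Matched x → κ x ≡ ε → Inner x × Inner (mate x)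

module SkeletonFacts {n : ℕ} (H : Skeleton n) where
  open Skeleton H

  Sibling? : ∀ x y → Dec (Sibling x y)
  Sibling? x y = Inner? x ×-dec (y ≟F sibling₁ x ⊎-dec y ≟F sibling₂ x)

  Sibling-Inner : ∀ {x y} → Sibling x y → Inner y
  Sibling-Inner x~y = proj₁ (Sibling-sym x~y)

  Sibling-Matched : ∀ {x y} → Sibling x y → Matched y
  Sibling-Matched x~y = Inner⇒Matched (Sibling-Inner x~y)

  mate-injective : ∀ {x y} → Matched x → Matched y → mate x ≡ mate y → x ≡ y
  mate-injective mx my e = trans (sym (mate-involutive mx)) (trans (cong mate e) (mate-involutive my))

  SameNode : Fin n → Fin n → Set
  SameNode x v = v ≡ x ⊎ Sibling x v

  SameNode? : ∀ x v → Dec (SameNode x v)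
  SameNode? x v = v ≟F x ⊎-dec Sibling? x v

  SameNode-Sibling : ∀ {x v w} → Sibling v w → SameNode x v → SameNode x w
  SameNode-Sibling v~w (inj₁ refl) = inj₂ v~w
  SameNode-Sibling {x} {w = w} v~w (inj₂ x~v) with w ≟F x
  ... | yes w≡x = inj₁ w≡x
  ... | no w≢x  = inj₂ (Sibling-trans (Sibling-sym x~v) v~w (w≢x ∘ sym))

  mate-leaves-node : ∀ {x w} → Inner x → SameNode x w → ¬ SameNode x (mate w)
  mate-leaves-node ix (inj₁ refl) (inj₁ e)   = mate-≢ (Inner⇒Matched ix) e
  mate-leaves-node ix (inj₁ refl) (inj₂ x~m) = mate-not-Sibling (Inner⇒Matched ix) x~m
  mate-leaves-node {x} ix (inj₂ x~w) (inj₁ e) =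
    mate-not-Sibling (Inner⇒Matched ix)
      (subst (Sibling x) (trans (sym (mate-involutive (Sibling-Matched x~w))) (cong mate e)) x~w)
  mate-leaves-node ix (inj₂ x~w) (inj₂ x~m) =
    mate-not-Sibling (Sibling-Matched x~w) (Sibling-trans x~w x~m λ e → mate-≢ (Sibling-Matched x~w) (sym e))

module LocallyMaximalCut {n : ℕ} (H : Skeleton n) where
  open Skeleton H
  open SkeletonFacts H

  Side : Set
  Side = Fin n → Bool

  Uncut : Side → Fin n → Set
  Uncut s x = Inner x × Inner (mate x) × s x ≡ s (mate x)

  Uncut? : ∀ s x → Dec (Uncut s x)
  Uncut? s x = Inner? x ×-dec Inner? (mate x) ×-dec (s x ≟B s (mate x))

  Uncut-mate : ∀ {s x} → Uncut s x → Uncut s (mate x)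
  Uncut-mate {s} (ix , imx , e) rewrite mate-involutive (Inner⇒Matched ix) = imx , ix , sym e

  NodeConstant : Side → Set
  NodeConstant s = ∀ {x y} → Sibling x y → s x ≡ s y

  LocallyMaximal : Side → Set
  LocallyMaximal s = ∀ {x y} → Sibling x y → Uncut s x → Uncut s y → ⊥

  uncut-count : Side → ℕ
  uncut-count s = sum (λ v → 𝟙 (Uncut? s v))

  TwoUncut : Side → Fin n → Set
  TwoUncut s x = Σ (Fin n) λ y → Sibling x y × Uncut s x × Uncut s y

  TwoUncut? : ∀ s x → Dec (TwoUncut s x)
  TwoUncut? s x with Inner? x | Uncut? s x
  ... | no ¬ix  | _       = no λ { (_ , x~y , _) → ¬ix (proj₁ x~y) }
  ... | yes _   | no ¬ux  = no λ { (_ , _ , ux , _) → ¬ux ux }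
  ... | yes ix  | yes ux with Uncut? s (sibling₁ x) | Uncut? s (sibling₂ x)
  ...   | yes u₁ | _      = yes (sibling₁ x , (ix , inj₁ refl) , ux , u₁)
  ...   | no _   | yes u₂ = yes (sibling₂ x , (ix , inj₂ refl) , ux , u₂)
  ...   | no ¬u₁ | no ¬u₂ =
          no λ { (_ , (_ , inj₁ refl) , _ , u) → ¬u₁ u ; (_ , (_ , inj₂ refl) , _ , u) → ¬u₂ u }

  flipNode : Side → Fin n → Side
  flipNode s x v = does (SameNode? x v) xor s v

  flipNode-in : ∀ s {x v} → SameNode x v → flipNode s x v ≡ not (s v)
  flipNode-in s {x} {v} xv rewrite dec-true (SameNode? x v) xv = refl

  flipNode-out : ∀ s {x v} → ¬ SameNode x v → flipNode s x v ≡ s v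
  flipNode-out s {x} {v} ¬xv rewrite dec-false (SameNode? x v) ¬xv = refl

  flipNode-NodeConstant : ∀ s x → NodeConstant s → NodeConstant (flipNode s x)
  flipNode-NodeConstant s x const {v} {w} v~w with toSum (SameNode? x v) | toSum (SameNode? x w)
  ... | inj₁ xv  | inj₁ xw  = trans (flipNode-in s xv) (trans (cong not (const v~w)) (sym (flipNode-in s xw)))
  ... | inj₂ ¬xv | inj₂ ¬xw = trans (flipNode-out s ¬xv) (trans (const v~w) (sym (flipNode-out s ¬xw)))
  ... | inj₁ xv  | inj₂ ¬xw = ⊥-elim (¬xw (SameNode-Sibling v~w xv))
  ... | inj₂ ¬xv | inj₁ xw  = ⊥-elim (¬xv (SameNode-Sibling (Sibling-sym v~w) xw))

  -- Flipping the side of a node with two uncut edges cuts both (four uncut ends disappear)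
  -- and uncuts at most its third edge (two ends appear).
  module FlipNode (s : Side) {x y : Fin n} (x~y : Sibling x y) (ux : Uncut s x) (uy : Uncut s y) where
    ix : Inner x
    ix = proj₁ x~y

    s′ : Side
    s′ = flipNode s x

    z : Fin n
    z with y ≟F sibling₁ x
    ... | yes _ = sibling₂ x
    ... | no _  = sibling₁ x

    node : ∀ {w} → SameNode x w → w ≡ x ⊎ w ≡ y ⊎ w ≡ z
    node (inj₁ e) = inj₁ e
    node {w} (inj₂ (_ , w∈)) with y ≟F sibling₁ x | proj₂ x~y
    ... | yes y≡₁ | _        = inj₂ (⊎-map₁ (λ e → trans e (sym y≡₁)) w∈)
    ... | no y≢₁  | inj₁ y≡₁ = ⊥-elim (y≢₁ y≡₁)
    ... | no _    | inj₂ y≡₂ = inj₂ (⊎-map₁ (λ e → trans e (sym y≡₂)) (⊎-swap w∈))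

    becomes-cut : ∀ {w} → SameNode x w → Uncut s w → ¬ Uncut s′ w × ¬ Uncut s′ (mate w)
    becomes-cut {w} xw (iw , _ , sw≡smw) =
      (λ (_ , _ , e) → contra e) ,
      (λ (_ , _ , e) → contra (sym (trans e (cong s′ (mate-involutive (Inner⇒Matched iw))))))
      where
        contra : s′ w ≡ s′ (mate w) → ⊥
        contra e = not-¬ refl (begin
          s w          ≡⟨ sw≡smw ⟩
          s (mate w)   ≡⟨ flipNode-out s (mate-leaves-node ix xw) ⟨
          s′ (mate w)  ≡⟨ e ⟨
          s′ w         ≡⟨ flipNode-in s xw ⟩
          not (s w)    ∎)
          where open ≡-Reasoning

    x≢y : x ≢ y
    x≢y = Sibling-irrefl x~y
    x≢mx : x ≢ mate x
    x≢mx e = mate-≢ (Inner⇒Matched ix) (sym e)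
    x≢my : x ≢ mate y
    x≢my e = mate-leaves-node ix (inj₂ x~y) (inj₁ (sym e))
    y≢mx : y ≢ mate x
    y≢mx e = mate-leaves-node ix (inj₁ refl) (inj₂ (subst (Sibling x) e x~y))
    y≢my : y ≢ mate y
    y≢my e = mate-≢ (Sibling-Matched x~y) (sym e)
    mx≢my : mate x ≢ mate y
    mx≢my e = x≢y (mate-injective (Inner⇒Matched ix) (Sibling-Matched x~y) e)

    lost gained : List (Fin n)
    lost   = x ∷ y ∷ mate x ∷ mate y ∷ []
    gained = z ∷ mate z ∷ []

    Lost : Fin n → Set
    Lost v = v ≡ x ⊎ v ≡ y ⊎ v ≡ mate x ⊎ v ≡ mate y

    Lost? : ∀ v → Dec (Lost v)
    Lost? v = v ≟F x ⊎-dec v ≟F y ⊎-dec v ≟F mate x ⊎-dec v ≟F mate y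

    Lost-uncut : ∀ {v} → Lost v → Uncut s v × ¬ Uncut s′ v
    Lost-uncut (inj₁ refl)                = ux , proj₁ (becomes-cut (inj₁ refl) ux)
    Lost-uncut (inj₂ (inj₁ refl))         = uy , proj₁ (becomes-cut (inj₂ x~y) uy)
    Lost-uncut (inj₂ (inj₂ (inj₁ refl)))  = Uncut-mate {s} ux , proj₂ (becomes-cut (inj₁ refl) ux)
    Lost-uncut (inj₂ (inj₂ (inj₂ refl)))  = Uncut-mate {s} uy , proj₂ (becomes-cut (inj₂ x~y) uy)

    hits-Lost : ∀ {v} → Lost v → hits lost v ≡ 1
    hits-Lost (inj₁ refl)
      rewrite dec-true (x ≟F x) refl | dec-false (x ≟F y) x≢y
            | dec-false (x ≟F mate x) x≢mx | dec-false (x ≟F mate y) x≢my = refl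
    hits-Lost (inj₂ (inj₁ refl))
      rewrite dec-false (y ≟F x) (x≢y ∘ sym) | dec-true (y ≟F y) refl
            | dec-false (y ≟F mate x) y≢mx | dec-false (y ≟F mate y) y≢my = refl
    hits-Lost (inj₂ (inj₂ (inj₁ refl)))
      rewrite dec-false (mate x ≟F x) (x≢mx ∘ sym) | dec-false (mate x ≟F y) (y≢mx ∘ sym)
            | dec-true (mate x ≟F mate x) refl | dec-false (mate x ≟F mate y) mx≢my = refl
    hits-Lost (inj₂ (inj₂ (inj₂ refl)))
      rewrite dec-false (mate y ≟F x) (x≢my ∘ sym) | dec-false (mate y ≟F y) (y≢my ∘ sym)
            | dec-false (mate y ≟F mate x) (mx≢my ∘ sym) | dec-true (mate y ≟F mate y) refl = refl

    hits-¬Lost : ∀ {v} → ¬ Lost v → hits lost v ≡ 0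
    hits-¬Lost {v} ¬lost
      rewrite dec-false (v ≟F x) (¬lost ∘ inj₁) | dec-false (v ≟F y) (¬lost ∘ inj₂ ∘ inj₁)
            | dec-false (v ≟F mate x) (¬lost ∘ inj₂ ∘ inj₂ ∘ inj₁)
            | dec-false (v ≟F mate y) (¬lost ∘ inj₂ ∘ inj₂ ∘ inj₂) = refl

    hits-gained : ∀ {v} → v ≡ z ⊎ v ≡ mate z → 1 ≤ hits gained v
    hits-gained (inj₁ refl) rewrite dec-true (z ≟F z) refl = s≤s z≤n
    hits-gained (inj₂ refl) rewrite dec-true (mate z ≟F mate z) refl = m≤n+m 1 (𝟙 (mate z ≟F z))

    unchanged : ∀ {v} → ¬ Lost v → ¬ (v ≡ z ⊎ v ≡ mate z) → Uncut s′ v → Uncut s v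
    unchanged {v} ¬lost ¬gained (iv , imv , e) =
      iv , imv , trans (sym (flipNode-out s outside)) (trans e (flipNode-out s mate-outside))
      where
        mmv : mate (mate v) ≡ v
        mmv = mate-involutive (Inner⇒Matched iv)
        outside : ¬ SameNode x v
        outside xv with node xv
        ... | inj₁ v≡x        = ¬lost (inj₁ v≡x)
        ... | inj₂ (inj₁ v≡y) = ¬lost (inj₂ (inj₁ v≡y))
        ... | inj₂ (inj₂ v≡z) = ¬gained (inj₁ v≡z)
        mate-outside : ¬ SameNode x (mate v)
        mate-outside xmv with node xmv
        ... | inj₁ e        = ¬lost (inj₂ (inj₂ (inj₁ (trans (sym mmv) (cong mate e)))))
        ... | inj₂ (inj₁ e) = ¬lost (inj₂ (inj₂ (inj₂ (trans (sym mmv) (cong mate e)))))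
        ... | inj₂ (inj₂ e) = ¬gained (inj₂ (trans (sym mmv) (cong mate e)))

    pointwise : ∀ v → 𝟙 (Uncut? s′ v) + hits lost v ≤ 𝟙 (Uncut? s v) + hits gained v
    pointwise v with Lost? v
    ... | yes lost-v rewrite hits-Lost lost-v
                           | 𝟙-no (Uncut? s′ v) (proj₂ (Lost-uncut lost-v))
                           | 𝟙-yes (Uncut? s v) (proj₁ (Lost-uncut lost-v)) = s≤s z≤n
    ... | no ¬lost rewrite hits-¬Lost ¬lost | +-identityʳ (𝟙 (Uncut? s′ v)) = survivor ¬lost
      where
        survivor : ¬ Lost v → 𝟙 (Uncut? s′ v) ≤ 𝟙 (Uncut? s v) + hits gained v
        survivor ¬lost with (v ≟F z) ⊎-dec (v ≟F mate z)
        ... | yes g = ≤-trans (𝟙≤1 (Uncut? s′ v)) (≤-trans (hits-gained g) (m≤n+m (hits gained v) (𝟙 (Uncut? s v))))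
        ... | no ¬g = ≤-trans (𝟙-mono (Uncut? s′ v) (Uncut? s v) (unchanged ¬lost ¬g))
                              (m≤m+n (𝟙 (Uncut? s v)) (hits gained v))

    uncut-count-decreases : uncut-count s′ < uncut-count s
    uncut-count-decreases =
      sum-<-exchange _ _ (hits lost) (hits gained) pointwise
        (subst₂ _<_ (sym (sum-hits gained)) (sym (sum-hits lost)) (s≤s (s≤s (s≤s z≤n))))

  locallyMaximalCut : Σ Side λ s → NodeConstant s × LocallyMaximal s
  locallyMaximalCut = improve (suc (uncut-count (λ _ → false))) (λ _ → false) (λ _ → refl) ≤-refl
    where
      improve : ∀ k s → NodeConstant s → uncut-count s < k → Σ Side λ s → NodeConstant s × LocallyMaximal s
      improve (suc k) s const bound with any? (TwoUncut? s)
      ... | no none = s , const , λ {x} x~y ux uy → none (x , _ , x~y , ux , uy)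
      ... | yes (x , y , x~y , ux , uy) =
        improve k (flipNode s x) (flipNode-NodeConstant s x const)
                (≤-trans (FlipNode.uncut-count-decreases s x~y ux uy) (s≤s⁻¹ bound))

-- König's argument: the cut edges of a locally maximal cut form a bipartite multigraph of maximum
-- degree 3; they are coloured one at a time, recolouring an alternating (Kempe) path when no
-- colour is free at both ends.
module KempeColouring {n : ℕ} (H : Skeleton n) where
  open Skeleton H
  open SkeletonFacts H
  open LocallyMaximalCut H

  _≟M_ : (a b : Maybe Colour) → Dec (a ≡ b)
  _≟M_ = ≡-dec-Maybe _≟F_

  PartialColouring : Set
  PartialColouring = Fin n → Maybe Colour

  module _ (s : Side) (const : NodeConstant s) (lmax : LocallyMaximal s) where

    record Valid (π : PartialColouring) : Set where
      field
        mate-agrees    : ∀ {x} → Matched x → π (mate x) ≡ π x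
        Sibling-differ : ∀ {x y c} → Sibling x y → π x ≡ just c → π y ≡ just c → ⊥
        ε⇒Uncut        : ∀ {x} → π x ≡ just ε → Uncut s x
        Uncut⇒ε        : ∀ {x} → Uncut s x → π x ≡ just ε

    Missing : PartialColouring → Fin n → Colour → Set
    Missing π x α = ∀ {y} → Sibling x y → π y ≢ just α

    Missing? : ∀ π x α → Dec (Missing π x α)
    Missing? π x α with Inner? x
    ... | no ¬ix = yes λ x~y → ⊥-elim (¬ix (proj₁ x~y))
    ... | yes ix with π (sibling₁ x) ≟M just α | π (sibling₂ x) ≟M just α
    ...   | yes e   | _      = no λ miss → miss (ix , inj₁ refl) e
    ...   | no _    | yes e  = no λ miss → miss (ix , inj₂ refl) e
    ...   | no ¬e₁  | no ¬e₂ = yes λ { (_ , inj₁ refl) → ¬e₁ ; (_ , inj₂ refl) → ¬e₂ }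

    missingColour : ∀ π x → Σ Colour λ α → α ≢ ε × Missing π x α
    missingColour π x with Inner? x
    ... | no ¬ix = 0F , (λ ()) , λ x~y → ⊥-elim (¬ix (proj₁ x~y))
    ... | yes ix with freeColour (fromMaybe ε (π (sibling₁ x))) (fromMaybe ε (π (sibling₂ x)))
    ...   | α , α≢ε , free₁ , free₂ =
            α , α≢ε , λ { (_ , inj₁ refl) → avoid free₁ ; (_ , inj₂ refl) → avoid free₂ }
      where
        avoid : ∀ {u} → fromMaybe ε u ≢ α → u ≢ just α
        avoid free refl = free refl

    initial : PartialColouring
    initial x = εIf (Uncut? s x)
      where
        εIf : ∀ {A} → Dec A → Maybe Colour
        εIf (yes _) = just ε
        εIf (no _)  = nothing

    initial-Uncut : ∀ {x} → Uncut s x → initial x ≡ just ε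
    initial-Uncut {x} u with Uncut? s x
    ... | yes _ = refl
    ... | no ¬u = ⊥-elim (¬u u)

    initial-¬Uncut : ∀ {x} → ¬ Uncut s x → initial x ≡ nothing
    initial-¬Uncut {x} ¬u with Uncut? s x
    ... | yes u = ⊥-elim (¬u u)
    ... | no _  = refl

    initial-coloured : ∀ {x c} → initial x ≡ just c → Uncut s x
    initial-coloured {x} e with Uncut? s x
    ... | yes u = u

    initial-valid : Valid initial
    initial-valid = record
      { mate-agrees    = mate-agrees
      ; Sibling-differ = λ x~y πx πy → lmax x~y (initial-coloured πx) (initial-coloured πy)
      ; ε⇒Uncut        = initial-coloured
      ; Uncut⇒ε        = initial-Uncut
      }
      where
        mate-agrees : ∀ {x} → Matched x → initial (mate x) ≡ initial x
        mate-agrees {x} mx with Uncut? s x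
        ... | yes u  = initial-Uncut (Uncut-mate {s} u)
        ... | no ¬u  = initial-¬Uncut λ u → ¬u (subst (Uncut s) (mate-involutive mx) (Uncut-mate {s} u))

    OnEdge : Fin n → Fin n → Set
    OnEdge x y = y ≡ x ⊎ y ≡ mate x

    paint : PartialColouring → Fin n → Colour → PartialColouring
    paint π x α y with (y ≟F x) ⊎-dec (y ≟F mate x)
    ... | yes _ = just α
    ... | no _  = π y

    paint-cases : ∀ π x α y → (OnEdge x y × paint π x α y ≡ just α) ⊎ (¬ OnEdge x y × paint π x α y ≡ π y)
    paint-cases π x α y with (y ≟F x) ⊎-dec (y ≟F mate x)
    ... | yes on = inj₁ (on , refl)
    ... | no off = inj₂ (off , refl)

    OnEdge-mate : ∀ {x y} → Matched x → Matched y → OnEdge x (mate y) → OnEdge x y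
    OnEdge-mate mx my (inj₁ e) = inj₂ (trans (sym (mate-involutive my)) (cong mate e))
    OnEdge-mate mx my (inj₂ e) = inj₁ (trans (sym (mate-involutive my)) (trans (cong mate e) (mate-involutive mx)))

    Sibling-not-on-edge : ∀ {x y z} → Matched x → Sibling y z → OnEdge x y → OnEdge x z → ⊥
    Sibling-not-on-edge mx y~z (inj₁ refl) (inj₁ refl) = Sibling-irrefl y~z refl
    Sibling-not-on-edge mx y~z (inj₁ refl) (inj₂ refl) = mate-not-Sibling mx y~z
    Sibling-not-on-edge {x} mx y~z (inj₂ refl) (inj₁ refl) =
      mate-not-Sibling (mate-Matched mx) (subst (Sibling (mate x)) (sym (mate-involutive mx)) y~z)
    Sibling-not-on-edge mx y~z (inj₂ refl) (inj₂ refl) = Sibling-irrefl y~z refl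

    Keeps : PartialColouring → PartialColouring → Set
    Keeps π π′ = ∀ y → π y ≢ nothing → π′ y ≢ nothing

    record Extension (π : PartialColouring) (x : Fin n) : Set where
      field
        π′       : PartialColouring
        valid    : Valid π′
        coloured : π′ x ≢ nothing
        keeps    : Keeps π π′

    module Paint (π : PartialColouring) (V : Valid π) {x : Fin n} {α : Colour} (mx : Matched x)
      (πx≡∅ : π x ≡ nothing) (α≢ε : α ≢ ε) (miss : Missing π x α) (miss′ : Missing π (mate x) α) where
      open Valid V

      mmx : mate (mate x) ≡ x
      mmx = mate-involutive mx

      πmx≡∅ : π (mate x) ≡ nothing
      πmx≡∅ = trans (mate-agrees mx) πx≡∅

      coloured : paint π x α x ≢ nothing
      coloured with paint-cases π x α x
      ... | inj₁ (_ , e)       = λ e′ → case trans (sym e) e′ of λ ()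
      ... | inj₂ (off , _)     = ⊥-elim (off (inj₁ refl))

      agrees : ∀ {y} → Matched y → paint π x α (mate y) ≡ paint π x α y
      agrees {y} my with paint-cases π x α y | paint-cases π x α (mate y)
      ... | inj₁ (_ , e₁)          | inj₁ (_ , e₂)       = trans e₂ (sym e₁)
      ... | inj₁ (inj₁ refl , _)   | inj₂ (off , _)      = ⊥-elim (off (inj₂ refl))
      ... | inj₁ (inj₂ refl , _)   | inj₂ (off , _)      = ⊥-elim (off (inj₁ mmx))
      ... | inj₂ (off , _)         | inj₁ (on , _)       = ⊥-elim (off (OnEdge-mate mx my on))
      ... | inj₂ (_ , e₁)          | inj₂ (_ , e₂)       = trans e₂ (trans (mate-agrees my) (sym e₁))

      Sibling-of-edge : ∀ {y z} → Sibling y z → OnEdge x y → π z ≢ just α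
      Sibling-of-edge y~z (inj₁ refl) = miss y~z
      Sibling-of-edge y~z (inj₂ refl) = miss′ y~z

      differ : ∀ {y z c} → Sibling y z → paint π x α y ≡ just c → paint π x α z ≡ just c → ⊥
      differ {y} {z} y~z ey ez with paint-cases π x α y | paint-cases π x α z
      ... | inj₁ (on-y , _)  | inj₁ (on-z , _)  = Sibling-not-on-edge mx y~z on-y on-z
      ... | inj₁ (on-y , e₁) | inj₂ (_ , e₂)    =
              Sibling-of-edge y~z on-y (trans (sym e₂) (trans ez (trans (sym ey) e₁)))
      ... | inj₂ (_ , e₁)    | inj₁ (on-z , e₂) =
              Sibling-of-edge (Sibling-sym y~z) on-z (trans (sym e₁) (trans ey (trans (sym ez) e₂)))
      ... | inj₂ (_ , e₁)    | inj₂ (_ , e₂)    = Sibling-differ y~z (trans (sym e₁) ey) (trans (sym e₂) ez)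

      ε-Uncut : ∀ {y} → paint π x α y ≡ just ε → Uncut s y
      ε-Uncut {y} e with paint-cases π x α y
      ... | inj₁ (_ , e₁) = ⊥-elim (α≢ε (just-injective (trans (sym e₁) e)))
      ... | inj₂ (_ , e₁) = ε⇒Uncut (trans (sym e₁) e)

      Uncut-ε : ∀ {y} → Uncut s y → paint π x α y ≡ just ε
      Uncut-ε {y} u with paint-cases π x α y
      ... | inj₁ (inj₁ refl , _) = case trans (sym πx≡∅) (Uncut⇒ε u) of λ ()
      ... | inj₁ (inj₂ refl , _) = case trans (sym πmx≡∅) (Uncut⇒ε u) of λ ()
      ... | inj₂ (_ , e₁)        = trans e₁ (Uncut⇒ε u)

      keeps : Keeps π (paint π x α)
      keeps y πy≢∅ with paint-cases π x α y
      ... | inj₁ (_ , e₁) = λ e → case trans (sym e₁) e of λ ()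
      ... | inj₂ (_ , e₁) = λ e → πy≢∅ (trans (sym e₁) e)

      valid : Valid (paint π x α)
      valid = record { mate-agrees = agrees ; Sibling-differ = differ ; ε⇒Uncut = ε-Uncut ; Uncut⇒ε = Uncut-ε }

    paint-Extension : ∀ π → Valid π → ∀ x α → Matched x → π x ≡ nothing → α ≢ ε →
                      Missing π x α → Missing π (mate x) α → Extension π x
    paint-Extension π V x α mx πx≡∅ α≢ε miss miss′ =
      record { π′ = paint π x α ; valid = P.valid ; coloured = P.coloured ; keeps = P.keeps }
      where module P = Paint π V mx πx≡∅ α≢ε miss miss′

    -- Swapping α and β along the α/β-chain starting at q frees α at mate x; the chain never reaches
    -- the node of x because it alternates between the two sides of the cut.
    module KempeChain (π : PartialColouring) (V : Valid π) {x : Fin n} (mx : Matched x)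
      (ix : Inner x) (imx : Inner (mate x)) (πx≡∅ : π x ≡ nothing)
      {α β : Colour} (α≢ε : α ≢ ε) (β≢ε : β ≢ ε) (α≢β : α ≢ β)
      (α-missing : Missing π x α) (β-missing : Missing π (mate x) β)
      {q : Fin n} (mx~q : Sibling (mate x) q) (πq : π q ≡ just α) where
      open Valid V

      AB : Colour → Set
      AB c = c ≡ α ⊎ c ≡ β

      AB-≢ε : ∀ {c} → AB c → c ≢ ε
      AB-≢ε (inj₁ refl) = α≢ε
      AB-≢ε (inj₂ refl) = β≢ε

      isα : Colour → Bool
      isα c = does (c ≟F α)

      isα-α : isα α ≡ true
      isα-α = dec-true (α ≟F α) refl

      isα-β : isα β ≡ false
      isα-β = dec-false (β ≟F α) (α≢β ∘ sym)

      swap : Colour → Colour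
      swap c = if isα c then β else α

      swap-α : swap α ≡ β
      swap-α rewrite isα-α = refl

      swap-β : swap β ≡ α
      swap-β rewrite isα-β = refl

      swap-AB : ∀ c → AB (swap c)
      swap-AB c with isα c
      ... | true  = inj₂ refl
      ... | false = inj₁ refl

      swap-injective : ∀ {c d} → AB c → AB d → swap c ≡ swap d → c ≡ d
      swap-injective (inj₁ refl) (inj₁ refl) _ = refl
      swap-injective (inj₁ refl) (inj₂ refl) e = ⊥-elim (α≢β (trans (sym swap-β) (trans (sym e) swap-α)))
      swap-injective (inj₂ refl) (inj₁ refl) e = ⊥-elim (α≢β (trans (sym swap-β) (trans e swap-α)))
      swap-injective (inj₂ refl) (inj₂ refl) _ = refl

      AB-split : ∀ {c d} → AB c → AB d → d ≡ c ⊎ d ≡ swap c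
      AB-split (inj₁ refl) (inj₁ refl) = inj₁ refl
      AB-split (inj₁ refl) (inj₂ refl) = inj₂ (sym swap-α)
      AB-split (inj₂ refl) (inj₁ refl) = inj₂ (sym swap-β)
      AB-split (inj₂ refl) (inj₂ refl) = inj₁ refl

      swap≡α : ∀ {c} → AB c → swap c ≡ α → c ≡ β
      swap≡α (inj₁ refl) e = ⊥-elim (α≢β (trans (sym e) swap-α))
      swap≡α (inj₂ refl) _ = refl

      isα-swap : ∀ {c} → AB c → isα (swap c) ≡ not (isα c)
      isα-swap (inj₁ refl) rewrite swap-α | isα-α = isα-β
      isα-swap (inj₂ refl) rewrite swap-β | isα-β = isα-α

      coloured-cut : ∀ {y c} → Inner y → Inner (mate y) → π y ≡ just c → c ≢ ε → s y ≢ s (mate y)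
      coloured-cut iy imy πy c≢ε e = c≢ε (just-injective (trans (sym πy) (Uncut⇒ε (iy , imy , e))))

      x-cut : s x ≢ s (mate x)
      x-cut e = case trans (sym (Uncut⇒ε (ix , imx , e))) πx≡∅ of λ ()

      siblingColoured : Fin n → Colour → Maybe (Fin n)
      siblingColoured w c with Inner? w | π (sibling₁ w) ≟M just c | π (sibling₂ w) ≟M just c
      ... | yes _ | yes _ | _     = just (sibling₁ w)
      ... | yes _ | no _  | yes _ = just (sibling₂ w)
      ... | yes _ | no _  | no _  = nothing
      ... | no _  | _     | _     = nothing

      siblingColoured-just : ∀ {w c z} → siblingColoured w c ≡ just z → Sibling w z × π z ≡ just c
      siblingColoured-just {w} {c} e with Inner? w | π (sibling₁ w) ≟M just c | π (sibling₂ w) ≟M just c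
      siblingColoured-just refl | yes iw | yes e₁ | _      = (iw , inj₁ refl) , e₁
      siblingColoured-just refl | yes iw | no _   | yes e₂ = (iw , inj₂ refl) , e₂

      siblingColoured-nothing : ∀ {w c} → siblingColoured w c ≡ nothing → Missing π w c
      siblingColoured-nothing {w} {c} e w~z with Inner? w | π (sibling₁ w) ≟M just c | π (sibling₂ w) ≟M just c
      siblingColoured-nothing refl (_ , inj₁ refl) | yes _ | no ¬e₁ | no _   = ¬e₁
      siblingColoured-nothing refl (_ , inj₂ refl) | yes _ | no _   | no ¬e₂ = ¬e₂
      siblingColoured-nothing refl w~z             | no ¬iw | _     | _      = ⊥-elim (¬iw (proj₁ w~z))

      chainStep : Fin n → Maybe (Fin n)
      chainStep y = π y >>= λ c → siblingColoured (mate y) (swap c)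

      chainStep-just : ∀ {y z c} → π y ≡ just c → chainStep y ≡ just z → Sibling (mate y) z × π z ≡ just (swap c)
      chainStep-just {y} {z} πy e =
        siblingColoured-just (subst (λ t → (t >>= λ c → siblingColoured (mate y) (swap c)) ≡ just z) πy e)

      chainStep-nothing : ∀ {y c} → π y ≡ just c → chainStep y ≡ nothing → Missing π (mate y) (swap c)
      chainStep-nothing {y} πy e =
        siblingColoured-nothing (subst (λ t → (t >>= λ c → siblingColoured (mate y) (swap c)) ≡ nothing) πy e)

      open Orbit chainStep q

      orbit-step⁻¹ : ∀ i {z} → orbit (suc i) ≡ just z → Σ (Fin n) λ y → orbit i ≡ just y × chainStep y ≡ just z
      orbit-step⁻¹ i e with orbit i
      ... | just y = y , refl , e

      -- The chain alternates sides of the cut and colours, so it is coloured α exactly on q's side.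
      OnChainInvariant : Fin n → Set
      OnChainInvariant y = Inner y × Σ Colour λ c → π y ≡ just c × AB c × isα c xor s y ≡ not (s q)

      chain-invariant : ∀ i {y} → orbit i ≡ just y → OnChainInvariant y
      chain-invariant zero refl = Sibling-Inner mx~q , α , πq , inj₁ refl , cong (_xor s q) isα-α
      chain-invariant (suc i) e with orbit-step⁻¹ i e
      ... | y , orbit-y , y↦z with chain-invariant i orbit-y
      ...   | iy , c , πy , ab , parity with chainStep-just πy y↦z
      ...     | my~z , πz = Sibling-Inner my~z , swap c , πz , swap-AB c , (begin
              isα (swap c) xor s _        ≡⟨ cong₂ _xor_ (isα-swap ab) (sym (const my~z)) ⟩
              not (isα c) xor s (mate y)  ≡⟨ cong (not (isα c) xor_) (¬-not (≢-sym (coloured-cut iy (proj₁ my~z) πy (AB-≢ε ab)))) ⟩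
              not (isα c) xor not (s y)   ≡⟨ not-distribˡ-xor (isα c) (not (s y)) ⟨
              not (isα c xor not (s y))   ≡⟨ cong not (not-distribʳ-xor (isα c) (s y)) ⟨
              not (not (isα c xor s y))   ≡⟨ not-involutive (isα c xor s y) ⟩
              isα c xor s y               ≡⟨ parity ⟩
              not (s q)                   ∎)
        where open ≡-Reasoning

      chain-mate-outside : ∀ i {y} → orbit i ≡ just y → ¬ SameNode x (mate y)
      chain-mate-outside i {y} e x-node with chain-invariant i e | x-node
      ... | iy , c , πy , _ , _ | inj₁ my≡x =
        case trans (sym πy) (trans (sym (mate-agrees (Inner⇒Matched iy))) (trans (cong π my≡x) πx≡∅)) of λ ()
      ... | iy , c , πy , inj₁ refl , _ | inj₂ x~my = α-missing x~my (trans (mate-agrees (Inner⇒Matched iy)) πy)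
      ... | iy , c , πy , inj₂ refl , parity | inj₂ x~my = x-cut (begin
            s x           ≡⟨ const x~my ⟩
            s (mate y)    ≡⟨ ¬-not (coloured-cut iy (Sibling-Inner x~my) πy β≢ε ∘ sym) ⟩
            not (s y)     ≡⟨ cong not (trans (sym (cong (_xor s y) isα-β)) parity) ⟩
            not (not (s q)) ≡⟨ not-involutive (s q) ⟩
            s q           ≡⟨ const mx~q ⟨
            s (mate x)    ∎)
        where open ≡-Reasoning

      chain-outside : ∀ i {y} → orbit i ≡ just y → ¬ SameNode x y
      chain-outside zero refl (inj₁ q≡x) =
        mate-not-Sibling (mate-Matched mx) (subst (Sibling (mate x)) (trans q≡x (sym (mate-involutive mx))) mx~q)
      chain-outside zero refl (inj₂ x~q) =
        mate-not-Sibling mx (Sibling-trans (Sibling-sym x~q) (Sibling-sym mx~q) λ e → mate-≢ mx (sym e))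
      chain-outside (suc i) e x-node with orbit-step⁻¹ i e
      ... | y , orbit-y , y↦z with chain-invariant i orbit-y
      ...   | _ , _ , πy , _ with chainStep-just πy y↦z | x-node
      ...     | my~z , _ | inj₁ refl = chain-mate-outside i orbit-y (inj₂ (Sibling-sym my~z))
      ...     | my~z , _ | inj₂ x~z with mate y ≟F x
      ...       | yes my≡x = chain-mate-outside i orbit-y (inj₁ my≡x)
      ...       | no my≢x  = chain-mate-outside i orbit-y
                               (inj₂ (Sibling-sym (Sibling-trans (Sibling-sym my~z) (Sibling-sym x~z) my≢x)))

      OnChain : Fin n → Set
      OnChain y = Σ (Fin (suc n)) λ j → orbit (toℕ j) ≡ just y

      OnChain? : ∀ y → Dec (OnChain y)
      OnChain? y = any? λ j → ≡-dec-Maybe _≟F_ (orbit (toℕ j)) (just y)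

      Swapped : Fin n → Set
      Swapped y = OnChain y ⊎ (Matched y × OnChain (mate y))

      Swapped? : ∀ y → Dec (Swapped y)
      Swapped? y = OnChain? y ⊎-dec (Matched? y ×-dec OnChain? (mate y))

      Swapped-colour : ∀ {y} → Swapped y → Σ Colour λ c → π y ≡ just c × AB c
      Swapped-colour (inj₁ (j , e)) with chain-invariant (toℕ j) e
      ... | _ , c , πy , ab , _ = c , πy , ab
      Swapped-colour (inj₂ (my , j , e)) with chain-invariant (toℕ j) e
      ... | _ , c , πmy , ab , _ = c , trans (sym (mate-agrees my)) πmy , ab

      Swapped-mate : ∀ {y} → Matched y → Swapped y → Swapped (mate y)
      Swapped-mate my (inj₁ on) = inj₂ (mate-Matched my , subst OnChain (sym (mate-involutive my)) on)
      Swapped-mate my (inj₂ (_ , on)) = inj₁ on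

      Swapped-Sibling : ∀ {y z d} → Swapped y → Sibling y z → π z ≡ just d → AB d → Swapped z
      Swapped-Sibling {y} {z} {d} (inj₁ (j , e)) y~z πz ab = go (toℕ j) e
        where
          go : ∀ i → orbit i ≡ just y → Swapped z
          go zero refl with z ≟F mate x
          ... | yes refl = case trans (sym πz) (trans (mate-agrees mx) πx≡∅) of λ ()
          ... | no z≢mx = q-siblings-not-AB ab
            where
              q-siblings-not-AB : AB d → Swapped z
              q-siblings-not-AB (inj₁ refl) = ⊥-elim (Sibling-differ y~z πq πz)
              q-siblings-not-AB (inj₂ refl) = ⊥-elim (β-missing (Sibling-trans (Sibling-sym mx~q) y~z (z≢mx ∘ sym)) πz)
          go (suc i) e′ with orbit-step⁻¹ i e′
          ... | w , orbit-w , w↦y with chain-invariant i orbit-w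
          ...   | iw , c , πw , abc , _ with chainStep-just πw w↦y
          ...     | mw~y , πy with z ≟F mate w
          ...       | yes refl = inj₂ (Sibling-Matched y~z ,
                                 orbit-bounded {i} (trans orbit-w (cong just (sym (mate-involutive (Inner⇒Matched iw))))))
          ...       | no z≢mw with AB-split abc ab
          ...         | inj₁ refl = ⊥-elim (Sibling-differ (Sibling-trans (Sibling-sym mw~y) y~z (z≢mw ∘ sym))
                                      (trans (mate-agrees (Inner⇒Matched iw)) πw) πz)
          ...         | inj₂ refl = ⊥-elim (Sibling-differ y~z πy πz)
      Swapped-Sibling {y} {z} (inj₂ (my , j , e)) y~z πz ab with chain-invariant (toℕ j) e
      ... | _ , c , πmy , abc , _ with AB-split abc ab
      ...   | inj₁ refl = ⊥-elim (Sibling-differ y~z (trans (sym (mate-agrees my)) πmy) πz)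
      ...   | inj₂ refl with chainStep (mate y) in my↦
      ...     | nothing = ⊥-elim (chainStep-nothing πmy my↦ (subst (λ t → Sibling t z) (sym (mate-involutive my)) y~z) πz)
      ...     | just z′ with z ≟F z′ | chainStep-just πmy my↦
      ...       | yes refl | _ = inj₁ (orbit-bounded {suc (toℕ j)} (trans (cong (_>>= chainStep) e) my↦))
      ...       | no z≢z′ | mmy~z′ , πz′ =
                  ⊥-elim (Sibling-differ (Sibling-trans y~z (subst (λ t → Sibling t z′) (mate-involutive my) mmy~z′) z≢z′)
                                         πz πz′)

      recoloured : PartialColouring
      recoloured y = if does (Swapped? y) then mapMaybe swap (π y) else π y

      recoloured-in : ∀ {y} → Swapped y → Σ Colour λ c → π y ≡ just c × AB c × recoloured y ≡ just (swap c)
      recoloured-in {y} sw with Swapped-colour sw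
      ... | c , πy , ab rewrite dec-true (Swapped? y) sw | πy = c , refl , ab , refl

      recoloured-out : ∀ {y} → ¬ Swapped y → recoloured y ≡ π y
      recoloured-out {y} ¬sw rewrite dec-false (Swapped? y) ¬sw = refl

      recoloured-agrees : ∀ {y} → Matched y → recoloured (mate y) ≡ recoloured y
      recoloured-agrees {y} my with toSum (Swapped? y)
      ... | inj₁ sw with recoloured-in sw | recoloured-in (Swapped-mate my sw)
      ...   | c , πy , _ , e | c′ , πmy , _ , e′ =
              trans (trans e′ (cong (just ∘ swap) (just-injective (trans (sym πmy) (trans (mate-agrees my) πy))))) (sym e)
      recoloured-agrees {y} my | inj₂ ¬sw =
        trans (recoloured-out ¬swm) (trans (mate-agrees my) (sym (recoloured-out ¬sw)))
        where
          ¬swm : ¬ Swapped (mate y)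
          ¬swm swm = ¬sw (subst Swapped (mate-involutive my) (Swapped-mate (mate-Matched my) swm))

      recoloured-differ : ∀ {y z c} → Sibling y z → recoloured y ≡ just c → recoloured z ≡ just c → ⊥
      recoloured-differ {y} {z} y~z ey ez with toSum (Swapped? y) | toSum (Swapped? z)
      ... | inj₁ swy | inj₁ swz with recoloured-in swy | recoloured-in swz
      ...   | a , πy , aba , e₁ | b , πz , abb , e₂ =
              Sibling-differ y~z πy (trans πz (cong just (sym (swap-injective aba abb
                (just-injective (trans (sym e₁) (trans ey (trans (sym ez) e₂))))))))
      recoloured-differ y~z ey ez | inj₁ swy | inj₂ ¬swz with recoloured-in swy
      ...   | a , _ , _ , e₁ =
              ¬swz (Swapped-Sibling swy y~z (trans (sym (recoloured-out ¬swz)) (trans ez (trans (sym ey) e₁))) (swap-AB a))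
      recoloured-differ y~z ey ez | inj₂ ¬swy | inj₁ swz with recoloured-in swz
      ...   | b , _ , _ , e₂ =
              ¬swy (Swapped-Sibling swz (Sibling-sym y~z)
                      (trans (sym (recoloured-out ¬swy)) (trans ey (trans (sym ez) e₂))) (swap-AB b))
      recoloured-differ y~z ey ez | inj₂ ¬swy | inj₂ ¬swz =
        Sibling-differ y~z (trans (sym (recoloured-out ¬swy)) ey) (trans (sym (recoloured-out ¬swz)) ez)

      recoloured-ε⇒Uncut : ∀ {y} → recoloured y ≡ just ε → Uncut s y
      recoloured-ε⇒Uncut {y} e with toSum (Swapped? y)
      ... | inj₁ sw with recoloured-in sw
      ...   | a , _ , _ , e₁ = ⊥-elim (AB-≢ε (swap-AB a) (just-injective (trans (sym e₁) e)))
      recoloured-ε⇒Uncut {y} e | inj₂ ¬sw = ε⇒Uncut (trans (sym (recoloured-out ¬sw)) e)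

      recoloured-Uncut⇒ε : ∀ {y} → Uncut s y → recoloured y ≡ just ε
      recoloured-Uncut⇒ε {y} u with toSum (Swapped? y)
      ... | inj₁ sw with Swapped-colour sw
      ...   | a , πy , aba = ⊥-elim (AB-≢ε aba (just-injective (trans (sym πy) (Uncut⇒ε u))))
      recoloured-Uncut⇒ε {y} u | inj₂ ¬sw = trans (recoloured-out ¬sw) (Uncut⇒ε u)

      recoloured-valid : Valid recoloured
      recoloured-valid = record
        { mate-agrees = recoloured-agrees ; Sibling-differ = recoloured-differ
        ; ε⇒Uncut = recoloured-ε⇒Uncut ; Uncut⇒ε = recoloured-Uncut⇒ε }

      x-not-Swapped : ¬ Swapped x
      x-not-Swapped (inj₁ (j , e)) = chain-outside (toℕ j) e (inj₁ refl)
      x-not-Swapped (inj₂ (_ , j , e)) = chain-mate-outside (toℕ j) e (inj₁ (mate-involutive mx))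

      recoloured-x : recoloured x ≡ nothing
      recoloured-x = trans (recoloured-out x-not-Swapped) πx≡∅

      recoloured-α-missing : Missing recoloured x α
      recoloured-α-missing {z} x~z = subst (_≢ just α) (sym (recoloured-out ¬sw)) (α-missing x~z)
        where
          ¬sw : ¬ Swapped z
          ¬sw (inj₁ (j , e)) = chain-outside (toℕ j) e (inj₂ x~z)
          ¬sw (inj₂ (mz , j , e)) = chain-mate-outside (toℕ j) e (inj₂ (subst (Sibling x) (sym (mate-involutive mz)) x~z))

      recoloured-α-missing-mate : Missing recoloured (mate x) α
      recoloured-α-missing-mate {z} mx~z e with toSum (Swapped? z)
      ... | inj₁ sw with recoloured-in sw
      ...   | a , πz , aba , e₁ = β-missing mx~z (trans πz (cong just (swap≡α aba (just-injective (trans (sym e₁) e)))))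
      recoloured-α-missing-mate {z} mx~z e | inj₂ ¬sw with z ≟F q
      ... | yes refl = ¬sw (inj₁ (zero , refl))
      ... | no z≢q = Sibling-differ (Sibling-trans mx~q mx~z (z≢q ∘ sym)) πq (trans (sym (recoloured-out ¬sw)) e)

      recoloured-keeps : ∀ y → π y ≢ nothing → recoloured y ≢ nothing
      recoloured-keeps y πy≢∅ with toSum (Swapped? y)
      ... | inj₁ sw with recoloured-in sw
      ...   | _ , _ , _ , e₁ = λ e → case trans (sym e₁) e of λ ()
      recoloured-keeps y πy≢∅ | inj₂ ¬sw = λ e → πy≢∅ (trans (sym (recoloured-out ¬sw)) e)

    Missing-witness : ∀ {π w α} → Inner w → ¬ Missing π w α → Σ (Fin n) λ q → Sibling w q × π q ≡ just α
    Missing-witness {π} {w} {α} iw ¬miss with π (sibling₁ w) ≟M just α | π (sibling₂ w) ≟M just α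
    ... | yes e₁ | _      = sibling₁ w , (iw , inj₁ refl) , e₁
    ... | no _   | yes e₂ = sibling₂ w , (iw , inj₂ refl) , e₂
    ... | no ¬e₁ | no ¬e₂ = ⊥-elim (¬miss λ { (_ , inj₁ refl) → ¬e₁ ; (_ , inj₂ refl) → ¬e₂ })

    Missing-¬Inner : ∀ {π w} α → ¬ Inner w → Missing π w α
    Missing-¬Inner α ¬iw w~z = ⊥-elim (¬iw (proj₁ w~z))

    extend : ∀ π → Valid π → ∀ x → Matched x → π x ≡ nothing → Extension π x
    extend π V x mx πx≡∅
      with any? (λ (α : Colour) → ¬? (α ≟F ε) ×-dec Missing? π x α ×-dec Missing? π (mate x) α)
    ... | yes (α , α≢ε , miss , miss′) = paint-Extension π V x α mx πx≡∅ α≢ε miss miss′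
    ... | no ¬common = record
      { π′ = Extension.π′ painted ; valid = Extension.valid painted ; coloured = Extension.coloured painted
      ; keeps = λ y πy≢∅ → Extension.keeps painted y (K.recoloured-keeps y πy≢∅) }
      where
        α β : Colour
        α = proj₁ (missingColour π x)
        β = proj₁ (missingColour π (mate x))
        α≢ε : α ≢ ε
        α≢ε = proj₁ (proj₂ (missingColour π x))
        β≢ε : β ≢ ε
        β≢ε = proj₁ (proj₂ (missingColour π (mate x)))
        α-missing : Missing π x α
        α-missing = proj₂ (proj₂ (missingColour π x))
        β-missing : Missing π (mate x) β
        β-missing = proj₂ (proj₂ (missingColour π (mate x)))
        α-present : ¬ Missing π (mate x) α
        α-present miss′ = ¬common (α , α≢ε , α-missing , miss′)
        α≢β : α ≢ β
        α≢β α≡β = α-present (subst (Missing π (mate x)) (sym α≡β) β-missing)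
        ix : Inner x
        ix = decidable-stable (Inner? x) λ ¬ix → ¬common (β , β≢ε , Missing-¬Inner {π} β ¬ix , β-missing)
        imx : Inner (mate x)
        imx = decidable-stable (Inner? (mate x)) λ ¬imx → α-present (Missing-¬Inner {π} α ¬imx)
        q : Σ (Fin n) λ q → Sibling (mate x) q × π q ≡ just α
        q = Missing-witness imx α-present
        module K = KempeChain π V mx ix imx πx≡∅ α≢ε β≢ε α≢β α-missing β-missing
                              (proj₁ (proj₂ q)) (proj₂ (proj₂ q))
        painted : Extension K.recoloured x
        painted = paint-Extension K.recoloured K.recoloured-valid x α mx K.recoloured-x α≢ε
                    K.recoloured-α-missing K.recoloured-α-missing-mate

    Complete : PartialColouring → List (Fin n) → Set
    Complete π ys = ∀ {y} → y ∈ ys → Matched y → π y ≢ nothing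

    extendAt : ∀ y π → Valid π →
               Σ PartialColouring λ π′ → Valid π′ × (Matched y → π′ y ≢ nothing) × Keeps π π′
    extendAt y π V with Matched? y | π y ≟M nothing
    ... | yes my | yes πy≡∅ = let E = extend π V y my πy≡∅ in
                               Extension.π′ E , Extension.valid E , (λ _ → Extension.coloured E) , Extension.keeps E
    ... | yes _  | no πy≢∅  = π , V , (λ _ → πy≢∅) , λ _ h → h
    ... | no ¬my | _        = π , V , (λ my → ⊥-elim (¬my my)) , λ _ h → h

    extendAll : ∀ ys π → Valid π → Σ PartialColouring λ π′ → Valid π′ × Complete π′ ys × Keeps π π′
    extendAll []       π V = π , V , (λ ()) , λ _ h → h
    extendAll (y ∷ ys) π V with extendAt y π V
    ... | π₁ , V₁ , y-coloured , keeps₁ with extendAll ys π₁ V₁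
    ...   | π₂ , V₂ , complete , keeps₂ = π₂ , V₂ , complete′ , λ z h → keeps₂ z (keeps₁ z h)
      where
        complete′ : Complete π₂ (y ∷ ys)
        complete′ (here refl) my = keeps₂ y (y-coloured my)
        complete′ (there z∈ys) mz = complete z∈ys mz

    colouring : SkeletonColouring H
    colouring with extendAll (allFin n) initial initial-valid
    ... | π , V , complete , _ = record
      { κ = κ ; κ-mate = κ-mate ; κ-Sibling = κ-Sibling ; κ-ε⇒Inner = κ-ε⇒Inner }
      where
        open Valid V
        -- The default 0F is only taken at unmatched vertices, where κ is never used.
        κ : Fin n → Colour
        κ y = fromMaybe 0F (π y)
        π≡κ : ∀ {y} → Matched y → π y ≡ just (κ y)
        π≡κ {y} my with π y | complete (∈-allFin y) my
        ... | just c  | _ = refl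
        ... | nothing | πy≢∅ = ⊥-elim (πy≢∅ refl)
        κ-mate : ∀ {x} → Matched x → κ (mate x) ≡ κ x
        κ-mate mx = cong (fromMaybe 0F) (mate-agrees mx)
        κ-Sibling : ∀ {x y} → Sibling x y → κ x ≢ κ y
        κ-Sibling x~y e =
          Sibling-differ x~y (π≡κ (Inner⇒Matched (proj₁ x~y))) (trans (π≡κ (Sibling-Matched x~y)) (cong just (sym e)))
        κ-ε⇒Inner : ∀ {x} → Matched x → κ x ≡ ε → Inner x × Inner (mate x)
        κ-ε⇒Inner mx e = let (ix , imx , _) = ε⇒Uncut (trans (π≡κ mx) (cong just e)) in ix , imx

skeletonColouring : ∀ {n} (H : Skeleton n) → SkeletonColouring H
skeletonColouring H = let (s , const , lmax) = locallyMaximalCut in KempeColouring.colouring H s const lmax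
  where open LocallyMaximalCut H

module LineGraphDistance {n : ℕ} (G : Graph n) where

  Ends : Fin n → Edge G → Set
  Ends x (u , v , _) = x ≡ u ⊎ x ≡ v

  WithinTwo : Fin n → Fin n → Set
  WithinTwo p q = p ≡ q ⊎ Graph.Adj G p q ⊎ Σ (Fin n) λ w → Graph.Adj G p w × Graph.Adj G w q

  LAdj-common-end : ∀ {e g} → LAdj G e g → Σ (Fin n) λ p → Ends p e × Ends p g
  LAdj-common-end {u , v , _} (_ , inj₁ e)                = u , inj₁ refl , inj₁ e
  LAdj-common-end {u , v , _} (_ , inj₂ (inj₁ e))         = u , inj₁ refl , inj₂ e
  LAdj-common-end {u , v , _} (_ , inj₂ (inj₂ (inj₁ e))) = v , inj₂ refl , inj₁ e
  LAdj-common-end {u , v , _} (_ , inj₂ (inj₂ (inj₂ e))) = v , inj₂ refl , inj₂ e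

  SameEdge-Ends : ∀ {g f p} → SameEdge G g f → Ends p g → Ends p f
  SameEdge-Ends (inj₁ (e₁ , e₂)) (inj₁ q) = inj₁ (trans q e₁)
  SameEdge-Ends (inj₁ (e₁ , e₂)) (inj₂ q) = inj₂ (trans q e₂)
  SameEdge-Ends (inj₂ (e₁ , e₂)) (inj₁ q) = inj₂ (trans q e₁)
  SameEdge-Ends (inj₂ (e₁ , e₂)) (inj₂ q) = inj₁ (trans q e₂)

  Ends-adjacent : ∀ {g p q} → Ends p g → Ends q g → p ≡ q ⊎ Graph.Adj G p q
  Ends-adjacent {_ , _ , a} (inj₁ refl) (inj₁ refl) = inj₁ refl
  Ends-adjacent {_ , _ , a} (inj₁ refl) (inj₂ refl) = inj₂ a
  Ends-adjacent {_ , _ , a} (inj₂ refl) (inj₁ refl) = inj₂ (Graph.sym G a)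
  Ends-adjacent {_ , _ , a} (inj₂ refl) (inj₂ refl) = inj₁ refl

  WithinTwo-via : ∀ {p q r} → p ≡ q ⊎ Graph.Adj G p q → q ≡ r ⊎ Graph.Adj G q r → WithinTwo p r
  WithinTwo-via (inj₁ refl) (inj₁ refl) = inj₁ refl
  WithinTwo-via (inj₁ refl) (inj₂ a)    = inj₂ (inj₁ a)
  WithinTwo-via (inj₂ a)    (inj₁ refl) = inj₂ (inj₁ a)
  WithinTwo-via {q = q} (inj₂ a) (inj₂ b) = inj₂ (inj₂ (q , a , b))

  Within1-common-end : ∀ {e f} → Within G e f 1 → ¬ SameEdge G e f → Σ (Fin n) λ p → Ends p e × Ends p f
  Within1-common-end (here same) ¬same = ⊥-elim (¬same same)
  Within1-common-end {e} {f} (step {g = g} e~g (here same)) _ with LAdj-common-end {e} {g} e~g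
  ... | p , pe , pg = p , pe , SameEdge-Ends {g} {f} same pg

  Within3-near-ends : ∀ {e f} → Within G e f 3 → ¬ SameEdge G e f →
                      Σ (Fin n) λ p → Σ (Fin n) λ q → Ends p e × Ends q f × WithinTwo p q
  Within3-near-ends (here same) ¬same = ⊥-elim (¬same same)
  Within3-near-ends {e} {f} (step {g = g} e~g (here same)) _ with LAdj-common-end {e} {g} e~g
  ... | p , pe , pg = p , p , pe , SameEdge-Ends {g} {f} same pg , inj₁ refl
  Within3-near-ends {e} {f} (step {g = g} e~g (step {g = h} g~h (here same))) _
    with LAdj-common-end {e} {g} e~g | LAdj-common-end {g} {h} g~h
  ... | p , pe , pg | q , qg , qh =
    p , q , pe , SameEdge-Ends {h} {f} same qh , WithinTwo-via (Ends-adjacent {g} pg qg) (inj₁ refl)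
  Within3-near-ends {e} {f} (step {g = g} e~g (step {g = h} g~h (step {g = k} h~k (here same)))) _
    with LAdj-common-end {e} {g} e~g | LAdj-common-end {g} {h} g~h | LAdj-common-end {h} {k} h~k
  ... | p , pe , pg | q , qg , qh | r , rh , rk =
    p , r , pe , SameEdge-Ends {k} {f} same rk , WithinTwo-via (Ends-adjacent {g} pg qg) (Ends-adjacent {h} qh rh)

module ClawFreeCubic {n : ℕ} (G : Graph n) (claw-free : ClawFree G) (cubic : Cubic G) where

  V : Set
  V = Fin n

  Adj : V → V → Set
  Adj = Graph.Adj G

  Adj-sym : ∀ {u v} → Adj u v → Adj v u
  Adj-sym = Graph.sym G

  Adj-irrefl : ∀ {u} → ¬ Adj u u
  Adj-irrefl = Graph.irrefl G

  Adj? : ∀ u v → Dec (Adj u v)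
  Adj? = Graph.dec G

  Adj⇒≢ : ∀ {u v} → Adj u v → u ≢ v
  Adj⇒≢ a refl = Adj-irrefl a

  record Nbrs (v a b c : V) : Set where
    field
      adj₁ : Adj v a
      adj₂ : Adj v b
      adj₃ : Adj v c
      ≢₁₂  : a ≢ b
      ≢₁₃  : a ≢ c
      ≢₂₃  : b ≢ c
      exhaust : ∀ w → Adj v w → w ≡ a ⊎ w ≡ b ⊎ w ≡ c
  open Nbrs public

  nbr₁ nbr₂ nbr₃ : V → V
  nbr₁ v = proj₁ (cubic v)
  nbr₂ v = proj₁ (proj₂ (cubic v))
  nbr₃ v = proj₁ (proj₂ (proj₂ (cubic v)))

  nbrs : ∀ v → Nbrs v (nbr₁ v) (nbr₂ v) (nbr₃ v)
  nbrs v with cubic v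
  ... | _ , _ , _ , a₁ , a₂ , a₃ , d₁₂ , d₁₃ , d₂₃ , ex = record
    { adj₁ = a₁ ; adj₂ = a₂ ; adj₃ = a₃ ; ≢₁₂ = d₁₂ ; ≢₁₃ = d₁₃ ; ≢₂₃ = d₂₃ ; exhaust = ex }

  Nbrs-swap₁₂ : ∀ {v a b c} → Nbrs v a b c → Nbrs v b a c
  Nbrs-swap₁₂ t = record
    { adj₁ = adj₂ t ; adj₂ = adj₁ t ; adj₃ = adj₃ t
    ; ≢₁₂ = ≢-sym (≢₁₂ t) ; ≢₁₃ = ≢₂₃ t ; ≢₂₃ = ≢₁₃ t
    ; exhaust = λ w a → case exhaust t w a of λ
        { (inj₁ e) → inj₂ (inj₁ e) ; (inj₂ (inj₁ e)) → inj₁ e ; (inj₂ (inj₂ e)) → inj₂ (inj₂ e) } }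

  Nbrs-swap₂₃ : ∀ {v a b c} → Nbrs v a b c → Nbrs v a c b
  Nbrs-swap₂₃ t = record
    { adj₁ = adj₁ t ; adj₂ = adj₃ t ; adj₃ = adj₂ t
    ; ≢₁₂ = ≢₁₃ t ; ≢₁₃ = ≢₁₂ t ; ≢₂₃ = ≢-sym (≢₂₃ t)
    ; exhaust = λ w a → case exhaust t w a of λ
        { (inj₁ e) → inj₁ e ; (inj₂ (inj₁ e)) → inj₂ (inj₂ e) ; (inj₂ (inj₂ e)) → inj₂ (inj₁ e) } }

  Nbrs-rotate : ∀ {v a b c} → Nbrs v a b c → Nbrs v c a b
  Nbrs-rotate = Nbrs-swap₁₂ ∘ Nbrs-swap₂₃

  Nbrs-subst : ∀ {v a b c a′ b′ c′} → a ≡ a′ → b ≡ b′ → c ≡ c′ → Nbrs v a b c → Nbrs v a′ b′ c′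
  Nbrs-subst refl refl refl t = t

  Nbrs-third : ∀ {v x y z w} → Nbrs v x y z → Adj v w → ¬ (w ≡ x ⊎ w ≡ y) → w ≡ z
  Nbrs-third t vw ¬xy with exhaust t _ vw
  ... | inj₁ e        = ⊥-elim (¬xy (inj₁ e))
  ... | inj₂ (inj₁ e) = ⊥-elim (¬xy (inj₂ e))
  ... | inj₂ (inj₂ e) = e

  nbr-cases : ∀ {v w} → Adj v w → w ≡ nbr₁ v ⊎ w ≡ nbr₂ v ⊎ w ≡ nbr₃ v
  nbr-cases {v} {w} = exhaust (nbrs v) w

  nbrs-with : ∀ {v w} → Adj v w → Σ V λ p → Σ V λ q → Nbrs v w p q
  nbrs-with {v} a with nbr-cases a
  ... | inj₁ refl        = nbr₂ v , nbr₃ v , nbrs v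
  ... | inj₂ (inj₁ refl) = nbr₁ v , nbr₃ v , Nbrs-swap₁₂ (nbrs v)
  ... | inj₂ (inj₂ refl) = nbr₁ v , nbr₂ v , Nbrs-rotate (nbrs v)

  nbrs-with₂ : ∀ {v a b} → Adj v a → Adj v b → a ≢ b → Σ V λ c → Nbrs v a b c
  nbrs-with₂ {b = b} va vb a≢b with nbrs-with va
  ... | p , q , t with exhaust t b vb
  ...   | inj₁ e        = ⊥-elim (a≢b (sym e))
  ...   | inj₂ (inj₁ e) = q , Nbrs-subst refl (sym e) refl t
  ...   | inj₂ (inj₂ e) = p , Nbrs-subst refl (sym e) refl (Nbrs-swap₂₃ t)

  nbrs-of : ∀ {v a b c} → Adj v a → Adj v b → Adj v c → a ≢ b → a ≢ c → b ≢ c → Nbrs v a b c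
  nbrs-of {c = c} va vb vc a≢b a≢c b≢c with nbrs-with₂ va vb a≢b
  ... | _ , t with exhaust t c vc
  ...   | inj₁ e        = ⊥-elim (a≢c (sym e))
  ...   | inj₂ (inj₁ e) = ⊥-elim (b≢c (sym e))
  ...   | inj₂ (inj₂ e) = Nbrs-subst refl refl (sym e) t

  CommonNbr : V → V → Set
  CommonNbr u v = Σ V λ w → Adj u w × Adj v w

  CommonNbr-sym : ∀ {u v} → CommonNbr u v → CommonNbr v u
  CommonNbr-sym (w , a , b) = w , b , a

  abstract
    CommonNbr? : ∀ u v → Dec (CommonNbr u v)
    CommonNbr? u v with Adj? v (nbr₁ u) | Adj? v (nbr₂ u) | Adj? v (nbr₃ u)
    ... | yes a | _     | _     = yes (nbr₁ u , adj₁ (nbrs u) , a)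
    ... | no _  | yes a | _     = yes (nbr₂ u , adj₂ (nbrs u) , a)
    ... | no _  | no _  | yes a = yes (nbr₃ u , adj₃ (nbrs u) , a)
    ... | no ¬a₁ | no ¬a₂ | no ¬a₃ = no λ (w , uw , vw) → case nbr-cases uw of λ
          { (inj₁ refl) → ¬a₁ vw ; (inj₂ (inj₁ refl)) → ¬a₂ vw ; (inj₂ (inj₂ refl)) → ¬a₃ vw }

  -- v is covered by the matching formed by the edges that lie in no triangle.
  Matched : V → Set
  Matched v = Σ V λ w → Adj v w × ¬ CommonNbr v w

  abstract
    Matched? : ∀ v → Dec (Matched v)
    Matched? v with CommonNbr? v (nbr₁ v) | CommonNbr? v (nbr₂ v) | CommonNbr? v (nbr₃ v)
    ... | no t  | _     | _     = yes (nbr₁ v , adj₁ (nbrs v) , t)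
    ... | yes _ | no t  | _     = yes (nbr₂ v , adj₂ (nbrs v) , t)
    ... | yes _ | yes _ | no t  = yes (nbr₃ v , adj₃ (nbrs v) , t)
    ... | yes t₁ | yes t₂ | yes t₃ = no λ (w , a , ¬t) → case nbr-cases a of λ
          { (inj₁ refl) → ¬t t₁ ; (inj₂ (inj₁ refl)) → ¬t t₂ ; (inj₂ (inj₂ refl)) → ¬t t₃ }

  ¬Matched⇒CommonNbr : ∀ {v w} → ¬ Matched v → Adj v w → CommonNbr v w
  ¬Matched⇒CommonNbr {v} {w} ¬mv a = decidable-stable (CommonNbr? v w) λ ¬t → ¬mv (w , a , ¬t)

  -- Two such edges at v, with the third neighbour of v, would form a claw.
  non-triangle-edge-unique : ∀ {v w w′} → Adj v w → ¬ CommonNbr v w → Adj v w′ → ¬ CommonNbr v w′ → w ≡ w′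
  non-triangle-edge-unique {v} {w} {w′} a ¬t a′ ¬t′ =
    decidable-stable (w ≟F w′) λ w≢w′ → let (u , t) = nbrs-with₂ a a′ w≢w′ in
      claw-free v w w′ u (a , a′ , adj₃ t , w≢w′ , ≢₁₃ t , ≢₂₃ t ,
        (λ ww′ → ¬t (w′ , a′ , ww′)) , (λ wu → ¬t (u , adj₃ t , wu)) ,
        (λ w′u → ¬t′ (u , adj₃ t , w′u)))

  abstract
    mate : V → V
    mate v with CommonNbr? v (nbr₁ v) | CommonNbr? v (nbr₂ v)
    ... | no _  | _    = nbr₁ v
    ... | yes _ | no _ = nbr₂ v
    ... | yes _ | yes _ = nbr₃ v

    mate-adj : ∀ v → Adj v (mate v)
    mate-adj v with CommonNbr? v (nbr₁ v) | CommonNbr? v (nbr₂ v)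
    ... | no _  | _     = adj₁ (nbrs v)
    ... | yes _ | no _  = adj₂ (nbrs v)
    ... | yes _ | yes _ = adj₃ (nbrs v)

    mate-no-triangle : ∀ {v} → Matched v → ¬ CommonNbr v (mate v)
    mate-no-triangle {v} (w , a , ¬t) with CommonNbr? v (nbr₁ v) | CommonNbr? v (nbr₂ v)
    ... | no ¬t₁ | _      = ¬t₁
    ... | yes _  | no ¬t₂ = ¬t₂
    ... | yes t₁ | yes t₂ with nbr-cases a
    ...   | inj₁ refl        = ⊥-elim (¬t t₁)
    ...   | inj₂ (inj₁ refl) = ⊥-elim (¬t t₂)
    ...   | inj₂ (inj₂ refl) = ¬t

  mate-unique : ∀ {v w} → Adj v w → ¬ CommonNbr v w → mate v ≡ w
  mate-unique {v} {w} a ¬t = non-triangle-edge-unique (mate-adj v) (mate-no-triangle (w , a , ¬t)) a ¬t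

  mate-Matched : ∀ {x} → Matched x → Matched (mate x)
  mate-Matched {x} mx = x , Adj-sym (mate-adj x) , mate-no-triangle mx ∘ CommonNbr-sym

  mate-involutive : ∀ {x} → Matched x → mate (mate x) ≡ x
  mate-involutive {x} mx = mate-unique (Adj-sym (mate-adj x)) (mate-no-triangle mx ∘ CommonNbr-sym)

  mate-≢ : ∀ {x} → mate x ≢ x
  mate-≢ {x} e = Adj⇒≢ (mate-adj x) (sym e)

  sibling₁ sibling₂ : V → V
  sibling₁ v = proj₁ (nbrs-with (mate-adj v))
  sibling₂ v = proj₁ (proj₂ (nbrs-with (mate-adj v)))

  mate-Nbrs : ∀ v → Nbrs v (mate v) (sibling₁ v) (sibling₂ v)
  mate-Nbrs v = proj₂ (proj₂ (nbrs-with (mate-adj v)))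

  adj-sibling₁ : ∀ v → Adj v (sibling₁ v)
  adj-sibling₁ v = adj₂ (mate-Nbrs v)

  adj-sibling₂ : ∀ v → Adj v (sibling₂ v)
  adj-sibling₂ v = adj₃ (mate-Nbrs v)

  mate-or-sibling : ∀ {v w} → Adj v w → w ≡ mate v ⊎ w ≡ sibling₁ v ⊎ w ≡ sibling₂ v
  mate-or-sibling {v} {w} = exhaust (mate-Nbrs v) w

  siblings-adjacent : ∀ {v y z} → Matched v → Nbrs v (mate v) y z → Adj y z
  siblings-adjacent {v} {y} {z} mv t = decidable-stable (Adj? y z) λ ¬yz →
    claw-free v (mate v) y z (adj₁ t , adj₂ t , adj₃ t , ≢₁₂ t , ≢₁₃ t , ≢₂₃ t ,
      (λ my → mate-no-triangle mv (y , adj₂ t , my)) , (λ mz → mate-no-triangle mv (z , adj₃ t , mz)) , ¬yz)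

  sibling₁-sibling₂ : ∀ {v} → Matched v → Adj (sibling₁ v) (sibling₂ v)
  sibling₁-sibling₂ {v} mv = siblings-adjacent mv (mate-Nbrs v)

  CommonNbr⇒sibling : ∀ {y a} → Matched y → Adj y a → CommonNbr y a → a ≡ sibling₁ y ⊎ a ≡ sibling₂ y
  CommonNbr⇒sibling {y} my ya t with mate-or-sibling ya
  ... | inj₁ e = ⊥-elim (mate-no-triangle my (subst (CommonNbr y) e t))
  ... | inj₂ s = s

  Inner : V → Set
  Inner v = Matched v × Matched (sibling₁ v) × Matched (sibling₂ v)

  Inner? : ∀ v → Dec (Inner v)
  Inner? v = Matched? v ×-dec Matched? (sibling₁ v) ×-dec Matched? (sibling₂ v)

  Sibling : V → V → Set
  Sibling x y = Inner x × (y ≡ sibling₁ x ⊎ y ≡ sibling₂ x)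

  triangle-siblings : ∀ {x y z} → Matched x → Matched y → Matched z → Adj y x → Adj y z → Adj x z →
                      Inner y × (x ≡ sibling₁ y ⊎ x ≡ sibling₂ y) × (z ≡ sibling₁ y ⊎ z ≡ sibling₂ y)
  triangle-siblings {x} {y} {z} mx my mz yx yz xz =
    (my , either-Matched (≢₂₃ (mate-Nbrs y)) x∈ z∈ , either-Matched (≢₂₃ (mate-Nbrs y) ∘ sym) (⊎-swap x∈) (⊎-swap z∈)) ,
    x∈ , z∈
    where
      x∈ : x ≡ sibling₁ y ⊎ x ≡ sibling₂ y
      x∈ = CommonNbr⇒sibling my yx (z , yz , xz)
      z∈ : z ≡ sibling₁ y ⊎ z ≡ sibling₂ y
      z∈ = CommonNbr⇒sibling my yz (x , yx , Adj-sym xz)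
      either-Matched : ∀ {p q} → p ≢ q → (x ≡ p ⊎ x ≡ q) → (z ≡ p ⊎ z ≡ q) → Matched p
      either-Matched _ (inj₁ refl) _           = mx
      either-Matched _ (inj₂ _)    (inj₁ refl) = mz
      either-Matched _ (inj₂ refl) (inj₂ refl) = ⊥-elim (Adj⇒≢ xz refl)

  Sibling-sym : ∀ {x y} → Sibling x y → Sibling y x
  Sibling-sym {x} ((mx , m₁ , m₂) , inj₁ refl) =
    let (iy , x∈ , _) = triangle-siblings mx m₁ m₂ (Adj-sym (adj-sibling₁ x)) (sibling₁-sibling₂ mx) (adj-sibling₂ x)
    in iy , x∈
  Sibling-sym {x} ((mx , m₁ , m₂) , inj₂ refl) =
    let (iy , x∈ , _) = triangle-siblings mx m₂ m₁ (Adj-sym (adj-sibling₂ x)) (Adj-sym (sibling₁-sibling₂ mx)) (adj-sibling₁ x)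
    in iy , x∈

  Sibling-trans : ∀ {x y z} → Sibling x y → Sibling x z → y ≢ z → Sibling y z
  Sibling-trans (_ , inj₁ e) (_ , inj₁ e′) y≢z = ⊥-elim (y≢z (trans e (sym e′)))
  Sibling-trans (_ , inj₂ e) (_ , inj₂ e′) y≢z = ⊥-elim (y≢z (trans e (sym e′)))
  Sibling-trans {x} ((mx , m₁ , m₂) , inj₁ refl) (_ , inj₂ refl) _ =
    let (iy , _ , z∈) = triangle-siblings mx m₁ m₂ (Adj-sym (adj-sibling₁ x)) (sibling₁-sibling₂ mx) (adj-sibling₂ x)
    in iy , z∈
  Sibling-trans {x} ((mx , m₁ , m₂) , inj₂ refl) (_ , inj₁ refl) _ =
    let (iy , _ , z∈) = triangle-siblings mx m₂ m₁ (Adj-sym (adj-sibling₂ x)) (Adj-sym (sibling₁-sibling₂ mx)) (adj-sibling₁ x)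
    in iy , z∈

  Sibling-Inner : ∀ {x y} → Sibling x y → Inner y
  Sibling-Inner = proj₁ ∘ Sibling-sym

  Sibling-Matched : ∀ {x y} → Sibling x y → Matched y
  Sibling-Matched = proj₁ ∘ Sibling-Inner

  Sibling-adjacent : ∀ {x y} → Sibling x y → Adj x y
  Sibling-adjacent {x} (_ , inj₁ refl) = adj-sibling₁ x
  Sibling-adjacent {x} (_ , inj₂ refl) = adj-sibling₂ x

  Sibling-irrefl : ∀ {x y} → Sibling x y → x ≢ y
  Sibling-irrefl = Adj⇒≢ ∘ Sibling-adjacent

  mate-not-Sibling : ∀ {x} → ¬ Sibling x (mate x)
  mate-not-Sibling {x} (_ , inj₁ e) = ≢₁₂ (mate-Nbrs x) e
  mate-not-Sibling {x} (_ , inj₂ e) = ≢₁₃ (mate-Nbrs x) e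

  skeleton : Skeleton n
  skeleton = record
    { Matched = Matched ; Matched? = Matched? ; Inner = Inner ; Inner? = Inner? ; Inner⇒Matched = proj₁
    ; mate = mate ; mate-Matched = mate-Matched ; mate-involutive = mate-involutive ; mate-≢ = λ _ → mate-≢
    ; sibling₁ = sibling₁ ; sibling₂ = sibling₂
    ; Sibling-sym = Sibling-sym ; Sibling-trans = Sibling-trans ; Sibling-irrefl = Sibling-irrefl
    ; mate-not-Sibling = λ _ → mate-not-Sibling }

  -- v lies in a K4 component.
  K4 : V → Set
  K4 v = ∀ {a b} → Adj v a → Adj v b → a ≢ b → Adj a b

  clique₃ : ∀ {a b x y z} → (a ≡ x ⊎ a ≡ y ⊎ a ≡ z) → (b ≡ x ⊎ b ≡ y ⊎ b ≡ z) → a ≢ b →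
            Adj x y → Adj x z → Adj y z → Adj a b
  clique₃ (inj₁ refl)        (inj₁ refl)        a≢b _  _  _  = ⊥-elim (a≢b refl)
  clique₃ (inj₁ refl)        (inj₂ (inj₁ refl)) _   xy _  _  = xy
  clique₃ (inj₁ refl)        (inj₂ (inj₂ refl)) _   _  xz _  = xz
  clique₃ (inj₂ (inj₁ refl)) (inj₁ refl)        _   xy _  _  = Adj-sym xy
  clique₃ (inj₂ (inj₁ refl)) (inj₂ (inj₁ refl)) a≢b _  _  _  = ⊥-elim (a≢b refl)
  clique₃ (inj₂ (inj₁ refl)) (inj₂ (inj₂ refl)) _   _  _  yz = yz
  clique₃ (inj₂ (inj₂ refl)) (inj₁ refl)        _   _  xz _  = Adj-sym xz
  clique₃ (inj₂ (inj₂ refl)) (inj₂ (inj₁ refl)) _   _  _  yz = Adj-sym yz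
  clique₃ (inj₂ (inj₂ refl)) (inj₂ (inj₂ refl)) a≢b _  _  _  = ⊥-elim (a≢b refl)

  abstract
    K4? : ∀ v → Dec (K4 v)
    K4? v with Adj? (nbr₁ v) (nbr₂ v) | Adj? (nbr₁ v) (nbr₃ v) | Adj? (nbr₂ v) (nbr₃ v)
    ... | yes a₁₂ | yes a₁₃ | yes a₂₃ = yes λ va vb a≢b → clique₃ (nbr-cases va) (nbr-cases vb) a≢b a₁₂ a₁₃ a₂₃
    ... | no ¬a₁₂ | _       | _       = no λ k → ¬a₁₂ (k (adj₁ (nbrs v)) (adj₂ (nbrs v)) (≢₁₂ (nbrs v)))
    ... | yes _   | no ¬a₁₃ | _       = no λ k → ¬a₁₃ (k (adj₁ (nbrs v)) (adj₃ (nbrs v)) (≢₁₃ (nbrs v)))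
    ... | yes _   | yes _   | no ¬a₂₃ = no λ k → ¬a₂₃ (k (adj₂ (nbrs v)) (adj₃ (nbrs v)) (≢₂₃ (nbrs v)))

  K4-adjacent : ∀ {u v} → Adj u v → K4 u → K4 v
  K4-adjacent {u} {v} uv k {a} {b} va vb a≢b with nbrs-with uv
  ... | p , q , t = clique₃ (exhaust tv a va) (exhaust tv b vb) a≢b (adj₂ t) (adj₃ t) (k (adj₂ t) (adj₃ t) (≢₂₃ t))
    where
      tv : Nbrs v u p q
      tv = nbrs-of (Adj-sym uv) (k uv (adj₂ t) (≢₁₂ t)) (k uv (adj₃ t) (≢₁₃ t)) (Adj⇒≢ (adj₂ t)) (Adj⇒≢ (adj₃ t)) (≢₂₃ t)

  unmatched-nbr-in-triangle : ∀ {u i j k} → ¬ Matched u → Nbrs u i j k → Adj i j ⊎ Adj i k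
  unmatched-nbr-in-triangle ¬mu t with ¬Matched⇒CommonNbr ¬mu (adj₁ t)
  ... | w , uw , iw with exhaust t w uw
  ...   | inj₁ refl        = ⊥-elim (Adj-irrefl iw)
  ...   | inj₂ (inj₁ refl) = inj₁ iw
  ...   | inj₂ (inj₂ refl) = inj₂ iw

  abstract
    diamond-middle-nbrs : ∀ {u} → ¬ Matched u → ¬ K4 u →
                          Σ V λ b → Σ V λ c → Σ V λ d → Nbrs u b c d × Adj b c × Adj b d × ¬ Adj c d
    diamond-middle-nbrs {u} ¬mu ¬k with Adj? (nbr₁ u) (nbr₂ u) | Adj? (nbr₁ u) (nbr₃ u) | Adj? (nbr₂ u) (nbr₃ u)
    ... | yes a₁₂ | yes a₁₃ | yes a₂₃ =
      ⊥-elim (¬k λ ua ub a≢b → clique₃ (nbr-cases ua) (nbr-cases ub) a≢b a₁₂ a₁₃ a₂₃)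
    ... | yes a₁₂ | yes a₁₃ | no ¬a₂₃ = nbr₁ u , nbr₂ u , nbr₃ u , nbrs u , a₁₂ , a₁₃ , ¬a₂₃
    ... | yes a₁₂ | no ¬a₁₃ | yes a₂₃ =
      nbr₂ u , nbr₁ u , nbr₃ u , Nbrs-swap₁₂ (nbrs u) , Adj-sym a₁₂ , a₂₃ , ¬a₁₃
    ... | no ¬a₁₂ | yes a₁₃ | yes a₂₃ =
      nbr₃ u , nbr₁ u , nbr₂ u , Nbrs-rotate (nbrs u) , Adj-sym a₁₃ , Adj-sym a₂₃ , ¬a₁₂
    ... | yes _   | no ¬a₁₃ | no ¬a₂₃ =
      ⊥-elim ([ ¬a₁₃ ∘ Adj-sym , ¬a₂₃ ∘ Adj-sym ]′ (unmatched-nbr-in-triangle ¬mu (Nbrs-rotate (nbrs u))))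
    ... | no ¬a₁₂ | yes _   | no ¬a₂₃ =
      ⊥-elim ([ ¬a₁₂ ∘ Adj-sym , ¬a₂₃ ]′ (unmatched-nbr-in-triangle ¬mu (Nbrs-swap₁₂ (nbrs u))))
    ... | no ¬a₁₂ | no ¬a₁₃ | _ =
      ⊥-elim ([ ¬a₁₂ , ¬a₁₃ ]′ (unmatched-nbr-in-triangle ¬mu (nbrs u)))

  -- K4 minus the edge cd.
  record Diamond (a b c d : V) : Set where
    field
      nbrs-a     : Nbrs a b c d
      nbrs-b     : Nbrs b a c d
      nbrs-c     : Nbrs c (mate c) a b
      nbrs-d     : Nbrs d (mate d) a b
      matched-c  : Matched c
      matched-d  : Matched d
      ¬matched-a : ¬ Matched a
      ¬matched-b : ¬ Matched b

  Diamond-swap-middle : ∀ {a b c d} → Diamond a b c d → Diamond b a c d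
  Diamond-swap-middle D = record
    { nbrs-a = nbrs-b ; nbrs-b = nbrs-a ; nbrs-c = Nbrs-swap₂₃ nbrs-c ; nbrs-d = Nbrs-swap₂₃ nbrs-d
    ; matched-c = matched-c ; matched-d = matched-d ; ¬matched-a = ¬matched-b ; ¬matched-b = ¬matched-a }
    where open Diamond D

  Diamond-swap-outer : ∀ {a b c d} → Diamond a b c d → Diamond a b d c
  Diamond-swap-outer D = record
    { nbrs-a = Nbrs-swap₂₃ nbrs-a ; nbrs-b = Nbrs-swap₂₃ nbrs-b ; nbrs-c = nbrs-d ; nbrs-d = nbrs-c
    ; matched-c = matched-d ; matched-d = matched-c ; ¬matched-a = ¬matched-a ; ¬matched-b = ¬matched-b }
    where open Diamond D

  diamond-outer : ∀ {a b c d} → Nbrs a b c d → Nbrs b a c d → ¬ Adj c d → Matched c × Nbrs c (mate c) a b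
  diamond-outer {a} {b} {c} {d} ta tb c≁d with nbrs-with₂ (Adj-sym (adj₂ ta)) (Adj-sym (adj₂ tb)) (Adj⇒≢ (adj₁ ta))
  ... | e , tc = (e , adj₃ tc , no-triangle) , Nbrs-subst (sym (mate-unique (adj₃ tc) no-triangle)) refl refl (Nbrs-rotate tc)
    where
      no-triangle : ¬ CommonNbr c e
      no-triangle (w , cw , ew) with exhaust tc w cw
      ... | inj₁ refl with exhaust ta e (Adj-sym ew)
      ...   | inj₁ refl        = ≢₂₃ tc refl
      ...   | inj₂ (inj₁ refl) = Adj-irrefl (adj₃ tc)
      ...   | inj₂ (inj₂ refl) = c≁d (adj₃ tc)
      no-triangle (w , cw , ew) | inj₂ (inj₁ refl) with exhaust tb e (Adj-sym ew)
      ...   | inj₁ refl        = ≢₁₃ tc refl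
      ...   | inj₂ (inj₁ refl) = Adj-irrefl (adj₃ tc)
      ...   | inj₂ (inj₂ refl) = c≁d (adj₃ tc)
      no-triangle (w , cw , ew) | inj₂ (inj₂ refl) = Adj-irrefl ew

  abstract
    diamond-at-middle : ∀ {a} → ¬ Matched a → ¬ K4 a → Σ V λ b → Σ V λ c → Σ V λ d → Diamond a b c d
    diamond-at-middle {a} ¬ma ¬k with diamond-middle-nbrs ¬ma ¬k
    ... | b , c , d , ta , bc , bd , c≁d = b , c , d , record
        { nbrs-a = ta ; nbrs-b = tb ; nbrs-c = proj₂ outer-c ; nbrs-d = proj₂ outer-d
        ; matched-c = proj₁ outer-c ; matched-d = proj₁ outer-d ; ¬matched-a = ¬ma ; ¬matched-b = ¬mb }
      where
        tb : Nbrs b a c d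
        tb = nbrs-of (Adj-sym (adj₁ ta)) bc bd (Adj⇒≢ (adj₂ ta)) (Adj⇒≢ (adj₃ ta)) (≢₂₃ ta)
        outer-c : Matched c × Nbrs c (mate c) a b
        outer-c = diamond-outer ta tb c≁d
        outer-d : Matched d × Nbrs d (mate d) a b
        outer-d = diamond-outer (Nbrs-swap₂₃ ta) (Nbrs-swap₂₃ tb) (c≁d ∘ Adj-sym)
        ¬mb : ¬ Matched b
        ¬mb (w , bw , ¬t) with exhaust tb w bw
        ... | inj₁ refl        = ¬t (c , bc , adj₂ ta)
        ... | inj₂ (inj₁ refl) = ¬t (a , Adj-sym (adj₁ ta) , Adj-sym (adj₂ ta))
        ... | inj₂ (inj₂ refl) = ¬t (a , Adj-sym (adj₁ ta) , Adj-sym (adj₃ ta))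

  sibling-¬K4 : ∀ {c a b} → Matched c → Nbrs c (mate c) a b → ¬ K4 a
  sibling-¬K4 {c} {a} mc tc k with nbrs-with₂ (Adj-sym (adj₂ tc)) (siblings-adjacent mc tc) (Adj⇒≢ (adj₃ tc))
  ... | x , tr with exhaust tc x (k (Adj-sym (adj₂ tc)) (adj₃ tr) (≢₁₃ tr))
  ...   | inj₁ e        = mate-no-triangle mc (a , adj₂ tc , subst (λ t → Adj t a) e (Adj-sym (adj₃ tr)))
  ...   | inj₂ (inj₁ e) = Adj-irrefl (subst (Adj a) e (adj₃ tr))
  ...   | inj₂ (inj₂ e) = ≢₂₃ tr (sym e)

  Diamond-fix-middle : ∀ {a b b′ c d} → Diamond a b′ c d → Nbrs c (mate c) a b → Diamond a b c d
  Diamond-fix-middle D tc with exhaust (Diamond.nbrs-c D) _ (adj₃ tc)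
  ... | inj₁ e           = ⊥-elim (≢₁₃ tc (sym e))
  ... | inj₂ (inj₁ e)    = ⊥-elim (≢₂₃ tc (sym e))
  ... | inj₂ (inj₂ refl) = D

  diamond-at-sibling : ∀ {c a b} → Matched c → Nbrs c (mate c) a b → ¬ Matched a → Σ V λ d → Diamond a b c d
  diamond-at-sibling {c} mc tc ¬ma with diamond-at-middle ¬ma (sibling-¬K4 mc tc)
  ... | _ , c′ , d′ , D with exhaust (Diamond.nbrs-a D) c (Adj-sym (adj₂ tc))
  ...   | inj₁ refl        = ⊥-elim (Diamond.¬matched-b D mc)
  ...   | inj₂ (inj₁ refl) = d′ , Diamond-fix-middle D tc
  ...   | inj₂ (inj₂ refl) = c′ , Diamond-fix-middle (Diamond-swap-outer D) tc

  diamond-at-outer : ∀ {c} → Matched c → ¬ Inner c → Σ V λ d → Diamond (sibling₁ c) (sibling₂ c) c d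
  diamond-at-outer {c} mc ¬ic with Matched? (sibling₁ c) | Matched? (sibling₂ c)
  ... | yes m₁ | yes m₂ = ⊥-elim (¬ic (mc , m₁ , m₂))
  ... | no ¬m₁ | _      = diamond-at-sibling mc (mate-Nbrs c) ¬m₁
  ... | yes _  | no ¬m₂ = let (d , D) = diamond-at-sibling mc (Nbrs-swap₂₃ (mate-Nbrs c)) ¬m₂ in d , Diamond-swap-middle D

  abstract
    otherSibling : V → V → V
    otherSibling u v = if does (v ≟F sibling₁ u) then sibling₂ u else sibling₁ u

    otherSibling-spec : ∀ {u y z} → Nbrs u (mate u) y z → otherSibling u y ≡ z
    otherSibling-spec {u} {y} {z} t with y ≟F sibling₁ u | mate-or-sibling (adj₂ t) | mate-or-sibling (adj₃ t)
    ... | _      | inj₁ e         | _              = ⊥-elim (≢₁₂ t (sym e))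
    ... | _      | _              | inj₁ e         = ⊥-elim (≢₁₃ t (sym e))
    ... | yes y₁ | _              | inj₂ (inj₁ z₁) = ⊥-elim (≢₂₃ t (trans y₁ (sym z₁)))
    ... | yes _  | _              | inj₂ (inj₂ z₂) = sym z₂
    ... | no ¬y₁ | inj₂ (inj₁ y₁) | _              = ⊥-elim (¬y₁ y₁)
    ... | no _   | inj₂ (inj₂ _)  | inj₂ (inj₁ z₁) = sym z₁
    ... | no _   | inj₂ (inj₂ y₂) | inj₂ (inj₂ z₂) = ⊥-elim (≢₂₃ t (trans y₂ (sym z₂)))

    thirdNbr : V → V → V → V
    thirdNbr v x y with (nbr₁ v ≟F x) ⊎-dec (nbr₁ v ≟F y) | (nbr₂ v ≟F x) ⊎-dec (nbr₂ v ≟F y)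
    ... | no _  | _     = nbr₁ v
    ... | yes _ | no _  = nbr₂ v
    ... | yes _ | yes _ = nbr₃ v

    thirdNbr-spec : ∀ {v x y z} → Nbrs v x y z → thirdNbr v x y ≡ z
    thirdNbr-spec {v} {x} {y} {z} t
      with (nbr₁ v ≟F x) ⊎-dec (nbr₁ v ≟F y) | (nbr₂ v ≟F x) ⊎-dec (nbr₂ v ≟F y)
    ... | no ¬₁  | _      = Nbrs-third t (adj₁ (nbrs v)) ¬₁
    ... | yes _  | no ¬₂  = Nbrs-third t (adj₂ (nbrs v)) ¬₂
    ... | yes e₁ | yes e₂ = Nbrs-third t (adj₃ (nbrs v)) ¬₃
      where
        ¬₃ : ¬ (nbr₃ v ≡ x ⊎ nbr₃ v ≡ y)
        ¬₃ e₃ = case (e₁ , e₂ , e₃) of λ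
          { (inj₁ p , inj₁ q , _) → ≢₁₂ (nbrs v) (trans p (sym q))
          ; (inj₂ p , inj₂ q , _) → ≢₁₂ (nbrs v) (trans p (sym q))
          ; (_ , inj₁ q , inj₁ r) → ≢₂₃ (nbrs v) (trans q (sym r))
          ; (_ , inj₂ q , inj₂ r) → ≢₂₃ (nbrs v) (trans q (sym r))
          ; (inj₁ p , _ , inj₁ r) → ≢₁₃ (nbrs v) (trans p (sym r))
          ; (inj₂ p , _ , inj₂ r) → ≢₁₃ (nbrs v) (trans p (sym r)) }

  -- The outer vertex of the diamond through u and its sibling v, other than u.
  oppositeOuter : V → V → V
  oppositeOuter u v = thirdNbr v u (otherSibling u v)

  module DiamondFacts {a b c d} (D : Diamond a b c d) where
    open Diamond D

    otherSibling-ca : otherSibling c a ≡ b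
    otherSibling-ca = otherSibling-spec nbrs-c

    oppositeOuter-ca : oppositeOuter c a ≡ d
    oppositeOuter-ca = trans (cong (thirdNbr a c) otherSibling-ca) (thirdNbr-spec (Nbrs-swap₁₂ nbrs-a))

    ¬Inner-outer : ∀ {x} → Nbrs x (mate x) a b → ¬ Inner x
    ¬Inner-outer tx (_ , m₁ , m₂) with mate-or-sibling (adj₂ tx)
    ... | inj₁ e        = ≢₁₂ tx (sym e)
    ... | inj₂ (inj₁ e) = ¬matched-a (subst Matched (sym e) m₁)
    ... | inj₂ (inj₂ e) = ¬matched-a (subst Matched (sym e) m₂)

  ClosedNbr : V → V → Set
  ClosedNbr u w = w ≡ u ⊎ Adj u w

  ClosedNbr-K4 : ∀ {u v w} → K4 u → Adj u v → ClosedNbr u w → ClosedNbr v w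
  ClosedNbr-K4 k uv (inj₁ refl) = inj₂ (Adj-sym uv)
  ClosedNbr-K4 {v = v} {w} k uv (inj₂ uw) with w ≟F v
  ... | yes w≡v = inj₁ w≡v
  ... | no w≢v  = inj₂ (k uv uw (≢-sym w≢v))

  -- A reference vertex shared by all four vertices of a K4 component.
  ρ : V → V
  ρ u = u ⊓F (nbr₁ u ⊓F (nbr₂ u ⊓F nbr₃ u))

  ρ-spec : ∀ u → ClosedNbr u (ρ u) × (∀ w → ClosedNbr u w → ρ u ≤F w)
  ρ-spec u = member , least
    where
      t : Nbrs u (nbr₁ u) (nbr₂ u) (nbr₃ u)
      t = nbrs u
      member : ClosedNbr u (ρ u)
      member with ⊓F-sel u (nbr₁ u ⊓F (nbr₂ u ⊓F nbr₃ u))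
      ... | inj₁ e = inj₁ e
      ... | inj₂ e with ⊓F-sel (nbr₁ u) (nbr₂ u ⊓F nbr₃ u)
      ...   | inj₁ e₁ = inj₂ (subst (Adj u) (sym (trans e e₁)) (adj₁ t))
      ...   | inj₂ e₁ with ⊓F-sel (nbr₂ u) (nbr₃ u)
      ...     | inj₁ e₂ = inj₂ (subst (Adj u) (sym (trans e (trans e₁ e₂))) (adj₂ t))
      ...     | inj₂ e₂ = inj₂ (subst (Adj u) (sym (trans e (trans e₁ e₂))) (adj₃ t))
      least : ∀ w → ClosedNbr u w → ρ u ≤F w
      least w (inj₁ refl) = ⊓F-≤ˡ u _
      least w (inj₂ a) with exhaust t w a
      ... | inj₁ refl        = Finₚ.≤-trans (⊓F-≤ʳ u _) (⊓F-≤ˡ (nbr₁ u) _)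
      ... | inj₂ (inj₁ refl) = Finₚ.≤-trans (⊓F-≤ʳ u _) (Finₚ.≤-trans (⊓F-≤ʳ (nbr₁ u) _) (⊓F-≤ˡ (nbr₂ u) _))
      ... | inj₂ (inj₂ refl) = Finₚ.≤-trans (⊓F-≤ʳ u _) (Finₚ.≤-trans (⊓F-≤ʳ (nbr₁ u) _) (⊓F-≤ʳ (nbr₂ u) _))

  ρ-K4 : ∀ {u v} → K4 u → Adj u v → ρ u ≡ ρ v
  ρ-K4 {u} {v} k uv = Finₚ.≤-antisym
    (proj₂ (ρ-spec u) (ρ v) (ClosedNbr-K4 (K4-adjacent uv k) (Adj-sym uv) (proj₁ (ρ-spec v))))
    (proj₂ (ρ-spec v) (ρ u) (ClosedNbr-K4 k uv (proj₁ (ρ-spec u))))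

  ClosedNbr-ρ : ∀ {u x} → K4 u → ClosedNbr u x → ClosedNbr (ρ u) x
  ClosedNbr-ρ {u} {x} k ux with proj₁ (ρ-spec u)
  ... | inj₁ e = subst (λ r → ClosedNbr r x) (sym e) ux
  ... | inj₂ a = ClosedNbr-K4 k a ux

  position : V → V → Colour
  position r w with w ≟F r
  ... | yes _ = ε
  ... | no _ with w ≟F nbr₁ r
  ...   | yes _ = 0F
  ...   | no _ with w ≟F nbr₂ r
  ...     | yes _ = 1F
  ...     | no _  = 2F

  vertexAt : V → Colour → V
  vertexAt r ε  = r
  vertexAt r 0F = nbr₁ r
  vertexAt r 1F = nbr₂ r
  vertexAt r 2F = nbr₃ r

  vertexAt-position : ∀ {r w} → ClosedNbr r w → vertexAt r (position r w) ≡ w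
  vertexAt-position {r} {w} rw with w ≟F r
  ... | yes e = sym e
  ... | no w≢r with w ≟F nbr₁ r
  ...   | yes e = sym e
  ...   | no w≢₁ with w ≟F nbr₂ r
  ...     | yes e = sym e
  ...     | no w≢₂ = sym (Nbrs-third (nbrs r) (adj rw) [ w≢₁ , w≢₂ ]′)
    where
      adj : ClosedNbr r w → Adj r w
      adj (inj₁ e) = ⊥-elim (w≢r e)
      adj (inj₂ a) = a

  position-injective : ∀ {r w w′} → ClosedNbr r w → ClosedNbr r w′ → position r w ≡ position r w′ → w ≡ w′
  position-injective {r} rw rw′ e = trans (sym (vertexAt-position rw)) (trans (cong (vertexAt r) e) (vertexAt-position rw′))

  -- Opposite edges of a K4 get the same colour, as the four labels ⊕-sum to ε: this colours a K4
  -- by its three perfect matchings.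
  K4Colour : V → V → Colour
  K4Colour u v = position (ρ u) u ⊕ position (ρ u) v

module PackingColouring {n : ℕ} (G : Graph n) (claw-free : ClawFree G) (cubic : Cubic G) where
  open ClawFreeCubic G claw-free cubic


  abstract
    κ : V → Colour
    κ = SkeletonColouring.κ (skeletonColouring skeleton)

    κ-mate : ∀ {x} → Matched x → κ (mate x) ≡ κ x
    κ-mate = SkeletonColouring.κ-mate (skeletonColouring skeleton)

    κ-Sibling : ∀ {x y} → Sibling x y → κ x ≢ κ y
    κ-Sibling = SkeletonColouring.κ-Sibling (skeletonColouring skeleton)

    κ-ε⇒Inner : ∀ {x} → Matched x → κ x ≡ ε → Inner x × Inner (mate x)
    κ-ε⇒Inner = SkeletonColouring.κ-ε⇒Inner (skeletonColouring skeleton)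

  triangleEdgeColour : V → V → Colour
  triangleEdgeColour u v = triangleColour (κ u) (κ v) (κ (otherSibling u v))

  -- The vertex order breaks the symmetry of a diamond consistently for all four of its sides.
  diamondEdgeColour : V → V → Colour
  diamondEdgeColour u v =
    diamondColour (κ u) (κ (oppositeOuter u v)) ((u <ᵇ oppositeOuter u v) xor (v <ᵇ otherSibling u v))

  colourFrom : V → V → Colour
  colourFrom u v with v ≟F mate u | Matched? v
  ... | yes _ | _     = κ u
  ... | no _  | yes _ = triangleEdgeColour u v
  ... | no _  | no _  = diamondEdgeColour u v

  colourFrom-mate : ∀ {u v} → v ≡ mate u → colourFrom u v ≡ κ u
  colourFrom-mate {u} {v} v≡mu with v ≟F mate u
  ... | yes _  = refl
  ... | no v≢mu = ⊥-elim (v≢mu v≡mu)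

  colourFrom-triangle : ∀ {u v} → v ≢ mate u → Matched v → colourFrom u v ≡ triangleEdgeColour u v
  colourFrom-triangle {u} {v} v≢mu mv with v ≟F mate u | Matched? v
  ... | yes v≡mu | _      = ⊥-elim (v≢mu v≡mu)
  ... | no _     | yes _  = refl
  ... | no _     | no ¬mv = ⊥-elim (¬mv mv)

  colourFrom-diamond : ∀ {u v} → v ≢ mate u → ¬ Matched v → colourFrom u v ≡ diamondEdgeColour u v
  colourFrom-diamond {u} {v} v≢mu ¬mv with v ≟F mate u | Matched? v
  ... | yes v≡mu | _     = ⊥-elim (v≢mu v≡mu)
  ... | no _     | yes mv = ⊥-elim (¬mv mv)
  ... | no _     | no _  = refl

  -- Unmatched vertices lie in a K4 component or are the middle vertices of a diamond.
  edgeColourBy : ∀ u v → Dec (Matched u) → Dec (Matched v) → Dec (K4 u) → Colour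
  edgeColourBy u v (yes _) _       _       = colourFrom u v
  edgeColourBy u v (no _)  (yes _) _       = colourFrom v u
  edgeColourBy u v (no _)  (no _)  (yes _) = K4Colour u v
  edgeColourBy u v (no _)  (no _)  (no _)  = ε

  edgeColour : V → V → Colour
  edgeColour u v = edgeColourBy u v (Matched? u) (Matched? v) (K4? u)

  edgeColour-matched : ∀ {u v} → Matched u → edgeColour u v ≡ colourFrom u v
  edgeColour-matched {u} {v} mu = go (Matched? u) (Matched? v) (K4? u)
    where
      go : ∀ d₁ d₂ d₃ → edgeColourBy u v d₁ d₂ d₃ ≡ colourFrom u v
      go (yes _)  _ _ = refl
      go (no ¬mu) _ _ = ⊥-elim (¬mu mu)

  edgeColour-to-matched : ∀ {u v} → ¬ Matched u → Matched v → edgeColour u v ≡ colourFrom v u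
  edgeColour-to-matched {u} {v} ¬mu mv = go (Matched? u) (Matched? v) (K4? u)
    where
      go : ∀ d₁ d₂ d₃ → edgeColourBy u v d₁ d₂ d₃ ≡ colourFrom v u
      go (yes mu) _        _ = ⊥-elim (¬mu mu)
      go (no _)   (yes _)  _ = refl
      go (no _)   (no ¬mv) _ = ⊥-elim (¬mv mv)

  edgeColour-K4 : ∀ {u v} → ¬ Matched u → ¬ Matched v → K4 u → edgeColour u v ≡ K4Colour u v
  edgeColour-K4 {u} {v} ¬mu ¬mv k = go (Matched? u) (Matched? v) (K4? u)
    where
      go : ∀ d₁ d₂ d₃ → edgeColourBy u v d₁ d₂ d₃ ≡ K4Colour u v
      go (yes mu) _       _       = ⊥-elim (¬mu mu)
      go (no _)   (yes mv) _      = ⊥-elim (¬mv mv)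
      go (no _)   (no _)  (yes _) = refl
      go (no _)   (no _)  (no ¬k) = ⊥-elim (¬k k)

  edgeColour-middle : ∀ {u v} → ¬ Matched u → ¬ Matched v → ¬ K4 u → edgeColour u v ≡ ε
  edgeColour-middle {u} {v} ¬mu ¬mv ¬k = go (Matched? u) (Matched? v) (K4? u)
    where
      go : ∀ d₁ d₂ d₃ → edgeColourBy u v d₁ d₂ d₃ ≡ ε
      go (yes mu) _        _       = ⊥-elim (¬mu mu)
      go (no _)   (yes mv) _       = ⊥-elim (¬mv mv)
      go (no _)   (no _)   (yes k) = ⊥-elim (¬k k)
      go (no _)   (no _)   (no _)  = refl

  Inner-nbr-Matched : ∀ {u y} → Inner u → Adj u y → Matched y
  Inner-nbr-Matched (mu , m₁ , m₂) uy with mate-or-sibling uy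
  ... | inj₁ refl        = mate-Matched mu
  ... | inj₂ (inj₁ refl) = m₁
  ... | inj₂ (inj₂ refl) = m₂

  Inner-nbr-Inner : ∀ {x w} → Inner x → Inner (mate x) → Adj x w → Inner w
  Inner-nbr-Inner ix imx xw with mate-or-sibling xw
  ... | inj₁ refl        = imx
  ... | inj₂ (inj₁ refl) = Sibling-Inner (ix , inj₁ refl)
  ... | inj₂ (inj₂ refl) = Sibling-Inner (ix , inj₂ refl)

  non-mate-Nbrs : ∀ {u v} → Adj u v → v ≢ mate u → Σ V λ z → Nbrs u (mate u) v z
  non-mate-Nbrs {u} uv v≢mu with mate-or-sibling uv
  ... | inj₁ e        = ⊥-elim (v≢mu e)
  ... | inj₂ (inj₁ refl) = sibling₂ u , mate-Nbrs u
  ... | inj₂ (inj₂ refl) = sibling₁ u , Nbrs-swap₂₃ (mate-Nbrs u)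

  sibling-mate-Nbrs : ∀ {u v z} → Matched u → Nbrs u (mate u) v z → Matched v → Nbrs v (mate v) u z
  sibling-mate-Nbrs {u} {v} {z} mu t mv =
    nbrs-of (mate-adj v) (Adj-sym (adj₂ t)) (siblings-adjacent mu t) mv≢u mv≢z (Adj⇒≢ (adj₃ t))
    where
      mv≢u : mate v ≢ u
      mv≢u refl = mate-no-triangle mv (z , siblings-adjacent mu t , adj₃ t)
      mv≢z : mate v ≢ z
      mv≢z refl = mate-no-triangle mv (u , Adj-sym (adj₂ t) , Adj-sym (adj₃ t))

  -- Otherwise u is an outer vertex of a diamond, whose siblings are unmatched.
  Inner-from-sibling : ∀ {u v z} → Matched u → Nbrs u (mate u) v z → Matched v → Inner u
  Inner-from-sibling {u} {v} {z} mu t mv with Matched? z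
  ... | no ¬mz = ⊥-elim (Diamond.¬matched-b (proj₂ (diamond-at-sibling mu (Nbrs-swap₂₃ t) ¬mz)) mv)
  ... | yes mz = mu , matched (adj-sibling₁ u) (≢₁₂ (mate-Nbrs u)) , matched (adj-sibling₂ u) (≢₁₃ (mate-Nbrs u))
    where
      matched : ∀ {x} → Adj u x → mate u ≢ x → Matched x
      matched ux mu≢x with exhaust t _ ux
      ... | inj₁ e           = ⊥-elim (mu≢x (sym e))
      ... | inj₂ (inj₁ refl) = mv
      ... | inj₂ (inj₂ refl) = mz

  diamond-at-outer-nbr : ∀ {c a} → Matched c → Adj c a → ¬ Matched a → Σ V λ b → Σ V λ d → Diamond a b c d
  diamond-at-outer-nbr {c} mc ca ¬ma with non-mate-Nbrs ca (λ { refl → ¬ma (mate-Matched mc) })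
  ... | b , t = b , diamond-at-sibling mc t ¬ma

  module DiamondColours {a b c d} (D : Diamond a b c d) where
    open Diamond D
    open DiamondFacts D

    κc-≢ε : κ c ≢ ε
    κc-≢ε e = ¬Inner-outer nbrs-c (proj₁ (κ-ε⇒Inner matched-c e))

    κd-≢ε : κ d ≢ ε
    κd-≢ε e = ¬Inner-outer nbrs-d (proj₁ (κ-ε⇒Inner matched-d e))

    σ : Bool
    σ = (c <ᵇ d) xor (a <ᵇ b)

    colourFrom-ca : colourFrom c a ≡ diamondColour (κ c) (κ d) σ
    colourFrom-ca = trans (colourFrom-diamond (≢₁₂ nbrs-c ∘ sym) ¬matched-a)
      (cong₂ (λ d′ b′ → diamondColour (κ c) (κ d′) ((c <ᵇ d′) xor (a <ᵇ b′))) oppositeOuter-ca otherSibling-ca)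

    colour-outer : edgeColour c a ≡ diamondColour (κ c) (κ d) σ
    colour-outer = trans (edgeColour-matched matched-c) colourFrom-ca

    colour-middle : edgeColour a c ≡ diamondColour (κ c) (κ d) σ
    colour-middle = trans (edgeColour-to-matched ¬matched-a matched-c) colourFrom-ca

  ProperAt : V → Set
  ProperAt u = ∀ {v w} → Adj u v → Adj u w → v ≢ w → edgeColour u v ≢ edgeColour u w

  ProperAt-Nbrs : ∀ {u x y z} → Nbrs u x y z → Distinct₃ (edgeColour u x) (edgeColour u y) (edgeColour u z) →
                  ProperAt u
  ProperAt-Nbrs t (xy , xz , yz) uv uw v≢w with exhaust t _ uv | exhaust t _ uw
  ... | inj₁ refl        | inj₁ refl        = ⊥-elim (v≢w refl)
  ... | inj₁ refl        | inj₂ (inj₁ refl) = xy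
  ... | inj₁ refl        | inj₂ (inj₂ refl) = xz
  ... | inj₂ (inj₁ refl) | inj₁ refl        = ≢-sym xy
  ... | inj₂ (inj₁ refl) | inj₂ (inj₁ refl) = ⊥-elim (v≢w refl)
  ... | inj₂ (inj₁ refl) | inj₂ (inj₂ refl) = yz
  ... | inj₂ (inj₂ refl) | inj₁ refl        = ≢-sym xz
  ... | inj₂ (inj₂ refl) | inj₂ (inj₁ refl) = ≢-sym yz
  ... | inj₂ (inj₂ refl) | inj₂ (inj₂ refl) = ⊥-elim (v≢w refl)

  edgeColour-mate : ∀ {u} → Matched u → edgeColour u (mate u) ≡ κ u
  edgeColour-mate mu = trans (edgeColour-matched mu) (colourFrom-mate refl)

  edgeColour-sibling : ∀ {u v z} → Matched u → Nbrs u (mate u) v z → Matched v →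
                       edgeColour u v ≡ triangleColour (κ u) (κ v) (κ z)
  edgeColour-sibling {u} mu t mv = trans (edgeColour-matched mu)
    (trans (colourFrom-triangle (≢₁₂ t ∘ sym) mv) (cong (λ z → triangleColour (κ u) _ (κ z)) (otherSibling-spec t)))

  ProperAt-Inner : ∀ {u} → Inner u → ProperAt u
  ProperAt-Inner {u} iu@(mu , m₁ , m₂) = ProperAt-Nbrs t
    (Distinct₃-subst (edgeColour-mate mu) (edgeColour-sibling mu t m₁) (edgeColour-sibling mu (Nbrs-swap₂₃ t) m₂)
      (triangleColour-proper (κ u) (κ (sibling₁ u)) (κ (sibling₂ u))
        (κ-Sibling (iu , inj₁ refl) , κ-Sibling (iu , inj₂ refl) ,
         κ-Sibling (Sibling-trans (iu , inj₁ refl) (iu , inj₂ refl) (≢₂₃ t)))))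
    where t = mate-Nbrs u

  ProperAt-outer : ∀ {u} → Matched u → ¬ Inner u → ProperAt u
  ProperAt-outer {u} mu ¬iu with diamond-at-outer mu ¬iu
  ... | d , D = ProperAt-Nbrs (mate-Nbrs u)
    (Distinct₃-subst (edgeColour-mate mu) colour-outer other-side
      (diamondColour-proper-outer (κ u) (κ d) σ κc-≢ε κd-≢ε))
    where
      open DiamondColours D
      other-side : edgeColour u (sibling₂ u) ≡ diamondColour (κ u) (κ d) (not σ)
      other-side = trans (DiamondColours.colour-outer (Diamond-swap-middle D))
        (cong (diamondColour (κ u) (κ d)) (trans (cong ((u <ᵇ d) xor_) (<ᵇ-flip (≢₂₃ (mate-Nbrs u))))
                                                 (sym (not-distribʳ-xor (u <ᵇ d) (sibling₁ u <ᵇ sibling₂ u)))))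

  ProperAt-middle : ∀ {u} → ¬ Matched u → ¬ K4 u → ProperAt u
  ProperAt-middle {u} ¬mu ¬k with diamond-at-middle ¬mu ¬k
  ... | b , c , d , D = ProperAt-Nbrs (Diamond.nbrs-a D)
    (Distinct₃-subst (edgeColour-middle ¬mu (Diamond.¬matched-b D) ¬k) colour-middle other-side
      (diamondColour-proper-middle (κ c) (κ d) σ κc-≢ε κd-≢ε))
    where
      open DiamondColours D
      other-side : edgeColour u d ≡ diamondColour (κ d) (κ c) (not σ)
      other-side = trans (DiamondColours.colour-middle (Diamond-swap-outer D))
        (cong (diamondColour (κ d) (κ c)) (trans (cong (_xor (u <ᵇ b)) (<ᵇ-flip (≢₂₃ (Diamond.nbrs-a D))))
                                                 (sym (not-distribˡ-xor (c <ᵇ d) (u <ᵇ b)))))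

  K4⇒¬Matched : ∀ {x} → K4 x → ¬ Matched x
  K4⇒¬Matched k (y , xy , ¬t) with nbrs-with xy
  ... | p , _ , t = ¬t (p , adj₂ t , k xy (adj₂ t) (≢₁₂ t))

  ProperAt-K4 : ∀ {u} → ¬ Matched u → K4 u → ProperAt u
  ProperAt-K4 {u} ¬mu k {v} {w} uv uw v≢w e =
    v≢w (position-injective (ClosedNbr-ρ k (inj₂ uv)) (ClosedNbr-ρ k (inj₂ uw))
      (⊕-cancelˡ (position (ρ u) u) (position (ρ u) v) (position (ρ u) w)
        (trans (sym (edgeColour-K4 ¬mu (K4⇒¬Matched (K4-adjacent uv k)) k))
               (trans e (edgeColour-K4 ¬mu (K4⇒¬Matched (K4-adjacent uw k)) k)))))

  edgeColour-proper : ∀ u → ProperAt u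
  edgeColour-proper u with toSum (Matched? u) | toSum (Inner? u) | toSum (K4? u)
  ... | inj₁ mu  | inj₁ iu  | _      = ProperAt-Inner iu
  ... | inj₁ mu  | inj₂ ¬iu | _      = ProperAt-outer mu ¬iu
  ... | inj₂ ¬mu | _        | inj₁ k  = ProperAt-K4 ¬mu k
  ... | inj₂ ¬mu | _        | inj₂ ¬k = ProperAt-middle ¬mu ¬k

  edgeColour-sym : ∀ {u v} → Adj u v → edgeColour u v ≡ edgeColour v u
  edgeColour-sym {u} {v} uv with toSum (Matched? u) | toSum (Matched? v)
  ... | inj₁ mu | inj₁ mv with toSum (v ≟F mate u)
  ...   | inj₁ refl = begin
          edgeColour u (mate u)                ≡⟨ edgeColour-mate mu ⟩
          κ u                                  ≡⟨ κ-mate mu ⟨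
          κ (mate u)                           ≡⟨ edgeColour-mate mv ⟨
          edgeColour (mate u) (mate (mate u))  ≡⟨ cong (edgeColour (mate u)) (mate-involutive mu) ⟩
          edgeColour (mate u) u                ∎
    where open ≡-Reasoning
  ...   | inj₂ v≢mu with non-mate-Nbrs uv v≢mu
  ...     | z , t = trans (edgeColour-sibling mu t mv)
                      (trans (triangleColour-comm (κ u) (κ v) (κ z))
                             (sym (edgeColour-sibling mv (sibling-mate-Nbrs mu t mv) mu)))
  edgeColour-sym uv | inj₁ mu  | inj₂ ¬mv = trans (edgeColour-matched mu) (sym (edgeColour-to-matched ¬mv mu))
  edgeColour-sym uv | inj₂ ¬mu | inj₁ mv  = trans (edgeColour-to-matched ¬mu mv) (sym (edgeColour-matched mv))
  edgeColour-sym {u} {v} uv | inj₂ ¬mu | inj₂ ¬mv with toSum (K4? u)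
  ... | inj₁ k  = trans (edgeColour-K4 ¬mu ¬mv k) (trans same-labels (sym (edgeColour-K4 ¬mv ¬mu (K4-adjacent uv k))))
    where
      same-labels : K4Colour u v ≡ K4Colour v u
      same-labels = trans (⊕-comm (position (ρ u) u) (position (ρ u) v))
                          (cong (λ r → position r v ⊕ position r u) (ρ-K4 k uv))
  ... | inj₂ ¬k = trans (edgeColour-middle ¬mu ¬mv ¬k) (sym (edgeColour-middle ¬mv ¬mu (¬k ∘ K4-adjacent (Adj-sym uv))))

  diamond-side-≢ε : ∀ {c a} → Matched c → Adj c a → ¬ Matched a → edgeColour c a ≢ ε
  diamond-side-≢ε mc ca ¬ma with diamond-at-outer-nbr mc ca ¬ma
  ... | b , d , D = λ ca-ε → proj₁ (diamondColour-proper-middle (κ _) (κ d) σ κc-≢ε κd-≢ε)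
                                   (sym (trans (sym colour-outer) ca-ε))
    where open DiamondColours D

  -- An ε-edge joins two inner vertices across the skeleton, or is the middle edge of a diamond.
  εKind : V → V → Set
  εKind u v = (Matched u × κ u ≡ ε × v ≡ mate u) ⊎ (¬ Matched u × ¬ K4 u × ¬ Matched v × ¬ K4 v)

  ε-kind : ∀ {u v} → Adj u v → edgeColour u v ≡ ε → εKind u v
  ε-kind {u} {v} uv uv-ε with toSum (Matched? u) | toSum (Matched? v)
  ... | inj₁ mu | _ with v ≟F mate u
  ...   | yes v≡mu = inj₁ (mu , trans (sym (trans (edgeColour-matched mu) (colourFrom-mate v≡mu))) uv-ε , v≡mu)
  ε-kind uv uv-ε | inj₁ mu | inj₂ ¬mv | no _ = ⊥-elim (diamond-side-≢ε mu uv ¬mv uv-ε)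
  ε-kind {u} {v} uv uv-ε | inj₁ mu | inj₁ mv | no v≢mu with non-mate-Nbrs uv v≢mu
  ... | z , t with mate-or-sibling uv
  ...   | inj₁ v≡mu = ⊥-elim (v≢mu v≡mu)
  ...   | inj₂ v∈ = ⊥-elim (triangleColour-≢ε (κ u) (κ v) (κ z) (κ-Sibling (Inner-from-sibling mu t mv , v∈))
                                               (trans (sym (edgeColour-sibling mu t mv)) uv-ε))
  ε-kind uv uv-ε | inj₂ ¬mu | inj₁ mv =
    ⊥-elim (diamond-side-≢ε mv (Adj-sym uv) ¬mu (trans (sym (edgeColour-sym uv)) uv-ε))
  ε-kind {u} {v} uv uv-ε | inj₂ ¬mu | inj₂ ¬mv with toSum (K4? u)
  ... | inj₂ ¬k = inj₂ (¬mu , ¬k , ¬mv , ¬k ∘ K4-adjacent (Adj-sym uv))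
  ... | inj₁ k  = ⊥-elim (⊕-≢ε (position (ρ u) u) (position (ρ u) v)
                    (Adj⇒≢ uv ∘ position-injective (ClosedNbr-ρ k (inj₁ refl)) (ClosedNbr-ρ k (inj₂ uv)))
                    (trans (sym (edgeColour-K4 ¬mu ¬mv k)) uv-ε))

  ε-not-Sibling : ∀ {x y} → κ x ≡ ε → κ y ≡ ε → ¬ Sibling x y
  ε-not-Sibling κx κy x~y = κ-Sibling x~y (trans κx (sym κy))

  εEdge : V → V → Set
  εEdge x x′ = Adj x x′ × edgeColour x x′ ≡ ε

  εEdge-unique : ∀ {x a b} → εEdge x a → εEdge x b → a ≡ b
  εEdge-unique {x} {a} {b} (xa , xa-ε) (xb , xb-ε) =
    decidable-stable (a ≟F b) λ a≢b → edgeColour-proper x xa xb a≢b (trans xa-ε (sym xb-ε))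

  SameEnds : V → V → V → V → Set
  SameEnds x x′ y y′ = (x ≡ y × x′ ≡ y′) ⊎ (x ≡ y′ × x′ ≡ y)

  εEdges-same-end : ∀ {x x′ y y′} → εEdge x x′ → εEdge y y′ → x ≡ y → SameEnds x x′ y y′
  εEdges-same-end εx εy refl = inj₁ (refl , εEdge-unique εx εy)

  εEdges-adjacent-ends : ∀ {x x′ y y′} → εEdge x x′ → εEdge y y′ → Adj x y → SameEnds x x′ y y′
  εEdges-adjacent-ends εx εy xy with ε-kind (proj₁ εx) (proj₂ εx) | ε-kind (proj₁ εy) (proj₂ εy)
  ... | inj₁ (mx , κx , x′≡) | inj₁ (my , κy , y′≡) with mate-or-sibling xy
  ...   | inj₁ y≡mx = inj₂ (sym (trans y′≡ (trans (cong mate y≡mx) (mate-involutive mx))) , trans x′≡ (sym y≡mx))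
  ...   | inj₂ y∈   = ⊥-elim (ε-not-Sibling κx κy (proj₁ (κ-ε⇒Inner mx κx) , y∈))
  εEdges-adjacent-ends εx εy xy | inj₁ (mx , κx , _) | inj₂ (¬my , _) =
    ⊥-elim (¬my (Inner-nbr-Matched (proj₁ (κ-ε⇒Inner mx κx)) xy))
  εEdges-adjacent-ends εx εy xy | inj₂ (¬mx , _) | inj₁ (my , κy , _) =
    ⊥-elim (¬mx (Inner-nbr-Matched (proj₁ (κ-ε⇒Inner my κy)) (Adj-sym xy)))
  εEdges-adjacent-ends εx εy xy | inj₂ (¬mx , ¬kx , _) | inj₂ (¬my , ¬ky , _) =
    inj₂ (sym (εEdge-unique εy (Adj-sym xy , edgeColour-middle ¬my ¬mx ¬ky)) ,
          εEdge-unique εx (xy , edgeColour-middle ¬mx ¬my ¬kx))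

  -- Each node of the skeleton meets at most one ε-edge, and mates have the same κ.
  inner-εEnds-close : ∀ {x y w} → Matched x → κ x ≡ ε → κ y ≡ ε → Adj x w → Adj w y → x ≡ y
  inner-εEnds-close {x} {y} {w} mx κx κy xw wy with mate-or-sibling xw | mate-or-sibling wy
  ... | inj₁ refl | inj₁ refl = sym (mate-involutive mx)
  ... | inj₁ refl | inj₂ y∈   = ⊥-elim (ε-not-Sibling (trans (κ-mate mx) κx) κy (proj₂ (κ-ε⇒Inner mx κx) , y∈))
  ... | inj₂ w∈   | inj₁ refl = ⊥-elim (ε-not-Sibling κx (trans (sym (κ-mate (Sibling-Matched x~w))) κy) x~w)
    where
      x~w : Sibling x w
      x~w = proj₁ (κ-ε⇒Inner mx κx) , w∈
  ... | inj₂ w∈   | inj₂ y∈   = decidable-stable (x ≟F y) λ x≢y →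
      ε-not-Sibling κx κy (Sibling-trans (Sibling-sym x~w) (Sibling-Inner x~w , y∈) x≢y)
    where
      x~w : Sibling x w
      x~w = proj₁ (κ-ε⇒Inner mx κx) , w∈

  εEdges-ends-at-distance-2 : ∀ {x x′ y y′ w} → εEdge x x′ → εEdge y y′ → Adj x w → Adj w y →
                              SameEnds x x′ y y′
  εEdges-ends-at-distance-2 εx εy xw wy with ε-kind (proj₁ εx) (proj₂ εx) | ε-kind (proj₁ εy) (proj₂ εy)
  ... | inj₁ (mx , κx , _) | inj₁ (_ , κy , _) = εEdges-same-end εx εy (inner-εEnds-close mx κx κy xw wy)
  εEdges-ends-at-distance-2 εx εy xw wy | inj₁ (mx , κx , _) | inj₂ (¬my , _) =
    ⊥-elim (¬my (Inner-nbr-Matched (Inner-nbr-Inner (proj₁ (κ-ε⇒Inner mx κx)) (proj₂ (κ-ε⇒Inner mx κx)) xw) wy))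
  εEdges-ends-at-distance-2 εx εy xw wy | inj₂ (¬mx , _) | inj₁ (my , κy , _) =
    ⊥-elim (¬mx (Inner-nbr-Matched (Inner-nbr-Inner (proj₁ (κ-ε⇒Inner my κy)) (proj₂ (κ-ε⇒Inner my κy)) (Adj-sym wy))
                                   (Adj-sym xw)))
  εEdges-ends-at-distance-2 {w = w} εx εy xw wy | inj₂ (¬mx , ¬kx , _) | inj₂ (¬my , _) with toSum (Matched? w)
  ... | inj₂ ¬mw = εEdges-same-end εx εy
                     (εEdge-unique (Adj-sym xw , edgeColour-middle ¬mw ¬mx ¬kw) (wy , edgeColour-middle ¬mw ¬my ¬kw))
    where
      ¬kw : ¬ K4 w
      ¬kw = ¬kx ∘ K4-adjacent (Adj-sym xw)
  ... | inj₁ mw with mate-or-sibling (Adj-sym xw) | mate-or-sibling wy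
  ...   | inj₁ refl        | _                = ⊥-elim (¬mx (mate-Matched mw))
  ...   | _                | inj₁ refl        = ⊥-elim (¬my (mate-Matched mw))
  ...   | inj₂ (inj₁ refl) | inj₂ (inj₁ refl) = εEdges-same-end εx εy refl
  ...   | inj₂ (inj₁ refl) | inj₂ (inj₂ refl) = εEdges-adjacent-ends εx εy (sibling₁-sibling₂ mw)
  ...   | inj₂ (inj₂ refl) | inj₂ (inj₁ refl) = εEdges-adjacent-ends εx εy (Adj-sym (sibling₁-sibling₂ mw))
  ...   | inj₂ (inj₂ refl) | inj₂ (inj₂ refl) = εEdges-same-end εx εy refl

  open LineGraphDistance G using (Ends; WithinTwo; Within1-common-end; Within3-near-ends)

  packingColour : Edge G → Colour
  packingColour (u , v , _) = edgeColour u v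

  packingColour-SameEdge : ∀ e f → SameEdge G e f → packingColour e ≡ packingColour f
  packingColour-SameEdge _ _         (inj₁ (refl , refl)) = refl
  packingColour-SameEdge (_ , _ , a) _ (inj₂ (refl , refl)) = edgeColour-sym a

  common-end-colours : ∀ {e f p} → Ends p e → Ends p f → ¬ SameEdge G e f → packingColour e ≢ packingColour f
  common-end-colours {u , v , a} {u′ , v′ , a′} (inj₁ refl) (inj₁ refl) ¬same e with v ≟F v′
  ... | yes v≡v′ = ¬same (inj₁ (refl , v≡v′))
  ... | no v≢v′  = edgeColour-proper u a a′ v≢v′ e
  common-end-colours {u , v , a} {u′ , v′ , a′} (inj₁ refl) (inj₂ refl) ¬same e with v ≟F u′
  ... | yes v≡u′ = ¬same (inj₂ (refl , v≡u′))
  ... | no v≢u′  = edgeColour-proper u a (Adj-sym a′) v≢u′ (trans e (edgeColour-sym a′))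
  common-end-colours {u , v , a} {u′ , v′ , a′} (inj₂ refl) (inj₁ refl) ¬same e with u ≟F v′
  ... | yes u≡v′ = ¬same (inj₂ (u≡v′ , refl))
  ... | no u≢v′  = edgeColour-proper v (Adj-sym a) a′ u≢v′ (trans (sym (edgeColour-sym a)) e)
  common-end-colours {u , v , a} {u′ , v′ , a′} (inj₂ refl) (inj₂ refl) ¬same e with u ≟F u′
  ... | yes u≡u′ = ¬same (inj₁ (u≡u′ , refl))
  ... | no u≢u′  =
    edgeColour-proper v (Adj-sym a) (Adj-sym a′) u≢u′ (trans (sym (edgeColour-sym a)) (trans e (edgeColour-sym a′)))

  Oriented : V → V → Edge G → Set
  Oriented p p′ (u , v , _) = (p ≡ u × p′ ≡ v) ⊎ (p ≡ v × p′ ≡ u)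

  εEdge-at : ∀ {e p} → Ends p e → packingColour e ≡ ε → Σ V λ p′ → εEdge p p′ × Oriented p p′ e
  εEdge-at {u , v , a} (inj₁ refl) e-ε = v , (a , e-ε) , inj₁ (refl , refl)
  εEdge-at {u , v , a} (inj₂ refl) e-ε = u , (Adj-sym a , trans (edgeColour-sym (Adj-sym a)) e-ε) , inj₂ (refl , refl)

  SameEnds⇒SameEdge : ∀ {e f p p′ q q′} → Oriented p p′ e → Oriented q q′ f → SameEnds p p′ q q′ →
                      SameEdge G e f
  SameEnds⇒SameEdge (inj₁ (refl , refl)) (inj₁ (refl , refl)) (inj₁ (e₁ , e₂)) = inj₁ (e₁ , e₂)
  SameEnds⇒SameEdge (inj₁ (refl , refl)) (inj₂ (refl , refl)) (inj₁ (e₁ , e₂)) = inj₂ (e₁ , e₂)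
  SameEnds⇒SameEdge (inj₂ (refl , refl)) (inj₁ (refl , refl)) (inj₁ (e₁ , e₂)) = inj₂ (e₂ , e₁)
  SameEnds⇒SameEdge (inj₂ (refl , refl)) (inj₂ (refl , refl)) (inj₁ (e₁ , e₂)) = inj₁ (e₂ , e₁)
  SameEnds⇒SameEdge (inj₁ (refl , refl)) (inj₁ (refl , refl)) (inj₂ (e₁ , e₂)) = inj₂ (e₁ , e₂)
  SameEnds⇒SameEdge (inj₁ (refl , refl)) (inj₂ (refl , refl)) (inj₂ (e₁ , e₂)) = inj₁ (e₁ , e₂)
  SameEnds⇒SameEdge (inj₂ (refl , refl)) (inj₁ (refl , refl)) (inj₂ (e₁ , e₂)) = inj₁ (e₂ , e₁)
  SameEnds⇒SameEdge (inj₂ (refl , refl)) (inj₂ (refl , refl)) (inj₂ (e₁ , e₂)) = inj₂ (e₂ , e₁)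

  εEdges-far : ∀ {e f p q} → Ends p e → Ends q f → WithinTwo p q →
               packingColour e ≡ ε → packingColour f ≡ ε → SameEdge G e f
  εEdges-far {e} {f} pe qf near e-ε f-ε with εEdge-at {e} pe e-ε | εEdge-at {f} qf f-ε
  ... | p′ , εp , oe | q′ , εq , of = SameEnds⇒SameEdge {e} {f} oe of (ends near)
    where
      ends : WithinTwo _ _ → SameEnds _ p′ _ q′
      ends (inj₁ p≡q)              = εEdges-same-end εp εq p≡q
      ends (inj₂ (inj₁ pq))        = εEdges-adjacent-ends εp εq pq
      ends (inj₂ (inj₂ (w , pw , wq))) = εEdges-ends-at-distance-2 εp εq pw wq

  S : Vec ℕ 4
  S = 1 ∷ 1 ∷ 1 ∷ 3 ∷ []

  packingColour-packed : ∀ e f → ¬ SameEdge G e f → packingColour e ≡ packingColour f →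
                         ¬ Within G e f (lookup S (packingColour e))
  packingColour-packed e f ¬same same-colour = packed (packingColour e) refl (sym same-colour)
    where
      matching : Within G e f 1 → ⊥
      matching within with Within1-common-end within ¬same
      ... | p , pe , pf = common-end-colours {e} {f} pe pf ¬same same-colour
      packed : ∀ c → packingColour e ≡ c → packingColour f ≡ c → ¬ Within G e f (lookup S c)
      packed 0F _ _ = matching
      packed 1F _ _ = matching
      packed 2F _ _ = matching
      packed ε e-ε f-ε within with Within3-near-ends within ¬same
      ... | p , q , pe , qf , near = ¬same (εEdges-far {e} {f} pe qf near e-ε f-ε)

theorem1p3 : ∀ {n : ℕ} (G : Graph n) → ClawFree G → Cubic G →
    PackingEdgeColoring G (1 ∷ 1 ∷ 1 ∷ 3 ∷ [])
theorem1p3 G claw-free cubic = packingColour , packingColour-SameEdge , packingColour-packed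
  where open PackingColouring G claw-free cubic
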